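{- Let $\pi$ be a nonempty permutation whose kernel shape is the kernel permutation $\rho\in\mathfrak S_s$, let $C^1\prec C^2\prec\cdots\prec C^{f(\rho)}$ be the feasible cells of the kernel cell decomposition of $\pi$, listed in the linear order $\prec$, and let $d_j=|C^j|$. Then $$\operatorname{sign}(\pi)=(-1)^{\left(\sum_{1\le i<j\le f(\rho)}d_id_j+\sum_{j=1}^{f(\rho)}d_j\,l_j(\rho)\right)}\cdot\operatorname{sign}(\rho)\cdot\prod_{j=1}^{f(\rho)}\operatorname{sign}(C^j).$$
   Context: Permutations $\pi\in\mathfrak S_n$ are written as words $\pi_1\cdots\pi_n$. An occurrence of $132$ in $\pi$ is a triple of indices $i<j<k$ with $\pi_i<\pi_k<\pi_j$. For a finite sequence of distinct numbers, $\operatorname{sign}$ is $(-1)^{\#\text{inversions}}$, where an inversion is a pair of positions $i<j$ whose entries are in decreasing order; the empty sequence has sign $1$. Kernel: form the bipartite graph $G_\pi$ whose vertices are the entries of $\pi$ and the occurrences of $132$ in $\pi$, an entry being joined to an occurrence if it belongs to it. The kernel of $\pi\in\mathfrak S_n$ is the subsequence $\pi(i_1),\dots,\pi(i_s)$ ($i_1<\dots<i_s$) of entries lying in the connected component of $G_\pi$ containing the entry $n$; the kernel shape is the permutation $\rho\in\mathfrak S_s$ order-isomorphic to it, and $s=s(\rho)$. A kernel permutation is a permutation that is the kernel shape of some permutation. Cells: for $1\le m\le s$, $1\le l\le s+1$, set $C_{ml}=\{\pi(j): i_{l-1}<j<i_l,\ \pi(i_{\rho^{ -1}(m-1)})<\pi(j)<\pi(i_{\rho^{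 -1}(m)})\}$, with conventions $i_0=0$, $i_{s+1}=n+1$, and the lower bound equal to $0$ when $m=1$. The cell $C_{ml}$ is infeasible if an element inserted into $\rho$ at a position between $\rho(l-1)$ and $\rho(l)$, with value strictly between $m-1$ and $m$, would form an occurrence of $132$ together with two entries of $\rho$; otherwise it is feasible. Every entry of $\pi$ outside the kernel lies in a feasible cell. For distinct feasible cells put $C_{ml}\prec C_{m'l'}$ if $m\ge m'$ and $l\le l'$; this is a linear order on the feasible cells. Their number is $f(\rho)$. Relative position: the $k$-th kernel entry lies below $C_{ml}$ if $\rho(k)<m$ and above it if $\rho(k)\ge m$; it lies to the left of $C_{ml}$ if $k<l$ and to the right if $k\ge l$. Define $l_j(\rho)$ as the number of $k\in[s]$ such that the $k$-th kernel entry is above and to the left of $C^j$, or below and to the right of $C^j$. $\operatorname{sign}(C^j)$ denotes the sign of the sequence of entries of $C^j$, read in the order in which they appear in $\pi$. -}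

module Defs where

open import Data.Nat using (ℕ; zero; suc; _+_; _*_; _∸_; _≤_; _<_; _<ᵇ_; _≤ᵇ_; _≡ᵇ_)
open import Data.Nat.Properties using (_<?_; _≟_)
open import Data.Bool using (Bool; true; false; _∧_; _∨_; not; if_then_else_)
open import Data.List using (List; []; _∷_; map; filter; filterᵇ; length; upTo; concatMap; reverse)
open import Data.Nat.ListAction using (sum)
open import Data.Bool.ListAction using (any)
open import Data.List.Membership.Propositional using (_∈_)
open import Data.List.Relation.Unary.AllPairs using (AllPairs)
open import Data.Product using (Σ; ∃; _×_; _,_)
open import Data.Sum using (_⊎_)
open import Data.Integer using (ℤ; -_; 1ℤ) renaming (_*_ to _*ℤ_)
open import Relation.Binary.PropositionalEquality using (_≡_)
open import Relation.Binary.Construct.Closure.ReflexiveTransitive using (Star)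

range : ℕ → List ℕ
range n = map suc (upTo n)

-- 1-based access to a list (default 0; only used with valid indices)
get0 : List ℕ → ℕ → ℕ
get0 [] _ = 0
get0 (x ∷ xs) zero = x
get0 (x ∷ xs) (suc k) = get0 xs k

nth : List ℕ → ℕ → ℕ
nth xs k = get0 xs (k ∸ 1)

inversions : List ℕ → ℕ
inversions [] = 0
inversions (x ∷ xs) = length (filter (_<? x) xs) + inversions xs

sgn : ℕ → ℤ
sgn zero = 1ℤ
sgn (suc e) = - sgn e

signSeq : List ℕ → ℤ
signSeq xs = sgn (inversions xs)

productℤ : List ℤ → ℤ
productℤ [] = 1ℤ
productℤ (x ∷ xs) = x *ℤ productℤ xs

pairSum : List ℕ → ℕ
pairSum [] = 0
pairSum (d ∷ ds) = d * sum ds + pairSum ds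

shape : List ℕ → List ℕ
shape xs = map (λ x → suc (length (filter (_<? x) xs))) xs

-- Permutations of [n] are functions π : ℕ → ℕ, only values on 1..n matter;
-- π j is the j-th letter of the word π₁ ⋯ πₙ.

IsPerm : ℕ → (ℕ → ℕ) → Set
IsPerm n π =
  (∀ j → 1 ≤ j → j ≤ n → 1 ≤ π j × π j ≤ n) ×
  (∀ i j → 1 ≤ i → i ≤ n → 1 ≤ j → j ≤ n → π i ≡ π j → i ≡ j)

Occ132 : ℕ → (ℕ → ℕ) → ℕ → ℕ → ℕ → Set
Occ132 n π x y z = 1 ≤ x × x < y × y < z × z ≤ n × π x < π z × π z < π y

In3 : ℕ → ℕ → ℕ → ℕ → Set
In3 a x y z = a ≡ x ⊎ a ≡ y ⊎ a ≡ z

-- entries (given by positions) a, b lie in a common occurrence of 132,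
-- i.e. are at distance 2 in the bipartite graph G_π
Adj : ℕ → (ℕ → ℕ) → ℕ → ℕ → Set
Adj n π a b = ∃ λ x → ∃ λ y → ∃ λ z → Occ132 n π x y z × In3 a x y z × In3 b x y z

-- position j carries an entry in the connected component of G_π containing the entry n
InKernel : ℕ → (ℕ → ℕ) → ℕ → Set
InKernel n π j = 1 ≤ j × j ≤ n ×
  (∃ λ p → 1 ≤ p × p ≤ n × π p ≡ n × Star (Adj n π) p j)

IsKernelPositions : ℕ → (ℕ → ℕ) → List ℕ → Set
IsKernelPositions n π ks =
  AllPairs _<_ ks × (∀ j → (j ∈ ks → InKernel n π j) × (InKernel n π j → j ∈ ks))

module Kernel (n : ℕ) (π : ℕ → ℕ) (ks : List ℕ) where

  s : ℕ
  s = length ks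

  ρL : List ℕ
  ρL = shape (map π ks)

  ρ : ℕ → ℕ
  ρ k = nth ρL k

  ipos : ℕ → ℕ
  ipos zero = 0
  ipos (suc k) = if suc k ≤ᵇ s then nth ks (suc k) else suc n

  ρinv : ℕ → ℕ
  ρinv m = nth (filterᵇ (λ k → ρ k ≡ᵇ m) (range s)) 1

  low : ℕ → ℕ
  low zero = 0
  low (suc zero) = 0
  low (suc (suc m)) = π (ipos (ρinv (suc m)))

  up : ℕ → ℕ
  up m = π (ipos (ρinv m))

  inCell : ℕ → ℕ → ℕ → Bool
  inCell m l j = (ipos (l ∸ 1) <ᵇ j) ∧ (j <ᵇ ipos l) ∧ (low m <ᵇ π j) ∧ (π j <ᵇ up m)

  cell : ℕ → ℕ → List ℕ
  cell m l = map π (filterᵇ (inCell m l) (range n))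

  -- ρ with a new element inserted between ρ(l-1) and ρ(l), with value
  -- strictly between m-1 and m (values doubled: ρ(k) ↦ 2ρ(k), new value 2m-1);
  -- a word of length s+1 indexed 1..s+1, the new element at position l
  ins : ℕ → ℕ → ℕ → ℕ
  ins m l p = if p <ᵇ l then 2 * ρ p else (if p ≡ᵇ l then 2 * m ∸ 1 else 2 * ρ (p ∸ 1))

  infeasible : ℕ → ℕ → Bool
  infeasible m l =
    any (λ a → any (λ b → any (λ c →
      (a <ᵇ b) ∧ (b <ᵇ c) ∧ (ins m l a <ᵇ ins m l c) ∧ (ins m l c <ᵇ ins m l b)
      ∧ ((a ≡ᵇ l) ∨ (b ≡ᵇ l) ∨ (c ≡ᵇ l))) (range (suc s))) (range (suc s))) (range (suc s))

  allCells : List (ℕ × ℕ)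
  allCells = concatMap (λ m → map (λ l → (m , l)) (range (suc s))) (reverse (range s))

  -- feasible cells C¹ ≺ C² ≺ ⋯ ≺ C^{f(ρ)}  (the linear order ≺ agrees with the listing above)
  feasibleCells : List (ℕ × ℕ)
  feasibleCells = filterᵇ (λ { (m , l) → not (infeasible m l) }) allCells

  d : ℕ × ℕ → ℕ
  d (m , l) = length (cell m l)

  -- l_j(ρ): kernel entries above-and-left or below-and-right of C_{ml}
  lval : ℕ × ℕ → ℕ
  lval (m , l) = length (filterᵇ (λ k → ((m ≤ᵇ ρ k) ∧ (k <ᵇ l)) ∨ ((ρ k <ᵇ m) ∧ (l ≤ᵇ k))) (range s))

  exponent : ℕ
  exponent = pairSum (map d feasibleCells) + sum (map (λ c → d c * lval c) feasibleCells)

  rhs : ℤ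
  rhs = sgn exponent *ℤ signSeq ρL *ℤ productℤ (map (λ { (m , l) → signSeq (cell m l) }) feasibleCells)

-- Count the inversions of π pair by pair of positions. Every position is a kernel position or
-- lies in exactly one feasible cell: an entry of an infeasible cell would complete an occurrence
-- of 132 with two kernel entries and so belong to the kernel. Kernel pairs contribute inv(ρ),
-- pairs inside C^j contribute inv(C^j), and an entry of C^j is inverted with the k-th kernel entry
-- exactly when that entry is above-left or below-right of C^j, which gives d_j l_j(ρ). Two entries
-- of different cells are always inverted: were they increasing, then, since the kernel contains n
-- and is closed under occurrences of 132, no kernel entry could lie between them in position or in
-- value, so they would share a cell. Hence inv(π) = inv(ρ) + Σ inv(C^j) + Σ d_j l_j + Σ_{i<j} d_i d_j.

module Submission where

open import Defs
open import Data.Nat using (ℕ; zero; suc; _+_; _*_; _∸_; _≤_; _<_; _≮_; _≰_; _<ᵇ_; _≤ᵇ_; _≡ᵇ_; z≤n; s≤s; s<s)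
open import Data.Nat.Properties
open import Data.Nat.ListAction using (sum)
open import Data.Nat.Solver using (module +-*-Solver)
open +-*-Solver using (solve; _:+_; _:=_)
open import Data.Bool using (Bool; true; false; _∧_; _∨_; not; if_then_else_)
open import Data.Bool.Properties using (T?; T-≡)
open import Data.Bool.ListAction using (any)
open import Data.Integer using (ℤ; -_) renaming (_*_ to _*ℤ_)
import Data.Integer.Properties as ℤ
open import Data.List using (List; []; _∷_; map; filter; filterᵇ; length; upTo; applyUpTo; reverse)
open import Data.List.Properties using (map-upTo; map-applyUpTo; map-∘; length-filter; length-map; map-cong)
open import Data.List.Membership.Propositional using (_∈_; find)
open import Data.List.Membership.DecPropositional _≟_ using (_∈?_)
open import Data.List.Membership.Propositional.Properties
  using (∈-map⁺; ∈-map⁻; ∈-upTo⁺; ∈-upTo⁻; ∈-filter⁺; ∈-filter⁻; ∈-concatMap⁺; ∈-concatMap⁻)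
open import Data.List.Relation.Unary.Any using (here; there)
import Data.List.Relation.Unary.Any as Any
import Data.List.Relation.Unary.Any.Properties as Any
open import Data.List.Relation.Unary.Any.Properties using (any⁻)
open import Data.List.Relation.Unary.All as All using (All; []; _∷_)
open import Data.List.Relation.Unary.AllPairs as AllPairs using (AllPairs; []; _∷_)
open import Data.List.Relation.Unary.AllPairs.Properties using (applyUpTo⁺₁)
import Data.List.Relation.Unary.AllPairs.Properties as AllPairs
open import Data.List.Relation.Unary.Unique.Propositional using (Unique)
import Data.List.Relation.Unary.Unique.Propositional.Properties as Unique
open import Data.List.Relation.Binary.Disjoint.Propositional using (Disjoint)
open import Data.Product using (∃; _×_; _,_; proj₁; proj₂)
open import Data.Sum using (_⊎_; inj₁; inj₂; [_,_])
open import Data.Empty using (⊥; ⊥-elim)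
open import Function using (_∘_; id)
open import Function.Bundles using (Equivalence)
open import Relation.Nullary using (¬_; yes; no; does)
open import Relation.Nullary.Reflects using (Reflects; ofʸ; ofⁿ; fromEquivalence)
open import Relation.Binary.Definitions using (Tri; tri<; tri≈; tri>)
open import Relation.Binary.PropositionalEquality
  using (_≡_; _≢_; refl; sym; trans; cong; cong₂; subst; subst₂; setoid; module ≡-Reasoning)
open import Relation.Binary.Construct.Closure.ReflexiveTransitive using (Star; ε; _◅_; _◅◅_)
open import Data.List.Relation.Binary.Permutation.Setoid (setoid ℕ) using (↭-sym)
open import Data.List.Relation.Binary.Permutation.Setoid.Properties (setoid ℕ) using (Unique-resp-↭; ↭-reverse)

reflects-true⁺ : ∀ {P : Set} {b} → Reflects P b → P → b ≡ true
reflects-true⁺ (ofʸ _) _ = refl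
reflects-true⁺ (ofⁿ ¬p) p = ⊥-elim (¬p p)

reflects-true⁻ : ∀ {P : Set} {b} → Reflects P b → b ≡ true → P
reflects-true⁻ (ofʸ p) _ = p

reflects-false⁺ : ∀ {P : Set} {b} → Reflects P b → ¬ P → b ≡ false
reflects-false⁺ (ofʸ p) ¬p = ⊥-elim (¬p p)
reflects-false⁺ (ofⁿ _) _ = refl

reflects-false⁻ : ∀ {P : Set} {b} → Reflects P b → b ≡ false → ¬ P
reflects-false⁻ (ofⁿ ¬p) _ = ¬p

≡ᵇ-reflects-≡ : ∀ m n → Reflects (m ≡ n) (m ≡ᵇ n)
≡ᵇ-reflects-≡ m n = fromEquivalence (≡ᵇ⇒≡ m n) (≡⇒≡ᵇ m n)

module _ {m n : ℕ} where

  <ᵇ-true⁺ : m < n → (m <ᵇ n) ≡ true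
  <ᵇ-true⁺ = reflects-true⁺ (<ᵇ-reflects-< m n)

  <ᵇ-true⁻ : (m <ᵇ n) ≡ true → m < n
  <ᵇ-true⁻ = reflects-true⁻ (<ᵇ-reflects-< m n)

  <ᵇ-false⁺ : m ≮ n → (m <ᵇ n) ≡ false
  <ᵇ-false⁺ = reflects-false⁺ (<ᵇ-reflects-< m n)

  <ᵇ-false⁻ : (m <ᵇ n) ≡ false → m ≮ n
  <ᵇ-false⁻ = reflects-false⁻ (<ᵇ-reflects-< m n)

  ≤ᵇ-true⁺ : m ≤ n → (m ≤ᵇ n) ≡ true
  ≤ᵇ-true⁺ = reflects-true⁺ (≤ᵇ-reflects-≤ m n)

  ≤ᵇ-false⁺ : m ≰ n → (m ≤ᵇ n) ≡ false
  ≤ᵇ-false⁺ = reflects-false⁺ (≤ᵇ-reflects-≤ m n)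

  ≡ᵇ-true⁺ : m ≡ n → (m ≡ᵇ n) ≡ true
  ≡ᵇ-true⁺ = reflects-true⁺ (≡ᵇ-reflects-≡ m n)

  ≡ᵇ-true⁻ : (m ≡ᵇ n) ≡ true → m ≡ n
  ≡ᵇ-true⁻ = reflects-true⁻ (≡ᵇ-reflects-≡ m n)

  ≡ᵇ-false⁺ : m ≢ n → (m ≡ᵇ n) ≡ false
  ≡ᵇ-false⁺ = reflects-false⁺ (≡ᵇ-reflects-≡ m n)

<ᵇ-irrefl : ∀ m → (m <ᵇ m) ≡ false
<ᵇ-irrefl m = <ᵇ-false⁺ {m} {m} (<-irrefl refl)

≤ᵇ≡not<ᵇ : ∀ m n → (m ≤ᵇ n) ≡ not (n <ᵇ m)
≤ᵇ≡not<ᵇ m n with n <? m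
... | yes n<m rewrite <ᵇ-true⁺ n<m = ≤ᵇ-false⁺ (<⇒≱ n<m)
... | no n≮m rewrite <ᵇ-false⁺ n≮m = ≤ᵇ-true⁺ (≮⇒≥ n≮m)

∧-true : ∀ {a b} → (a ∧ b) ≡ true → a ≡ true × b ≡ true
∧-true {true} {true} refl = refl , refl

∨-true : ∀ {a b} → (a ∨ b) ≡ true → a ≡ true ⊎ b ≡ true
∨-true {true} _ = inj₁ refl
∨-true {false} {true} _ = inj₂ refl

module _ {A : Set} {b : Bool} {x y : A} where

  if-true : b ≡ true → (if b then x else y) ≡ x
  if-true refl = refl

  if-false : b ≡ false → (if b then x else y) ≡ y
  if-false refl = refl

any-true⁻ : ∀ {A : Set} (p : A → Bool) xs → any p xs ≡ true → ∃ λ x → x ∈ xs × p x ≡ true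
any-true⁻ p xs holds =
  let (x , x∈ , px) = find (any⁻ p xs (Equivalence.from T-≡ holds)) in x , x∈ , Equivalence.to T-≡ px

m<n⇒m≤n∸1 : ∀ {m n} → m < n → m ≤ n ∸ 1
m<n⇒m≤n∸1 {n = suc _} (s≤s m≤n) = m≤n

2x<2y⇒x<y : ∀ {x y} → 2 * x < 2 * y → x < y
2x<2y⇒x<y {x} {y} = *-cancelˡ-< 2 x y

2x<2m∸1⇒x<m : ∀ {x m} → 2 * x < 2 * m ∸ 1 → x < m
2x<2m∸1⇒x<m {x} {m} 2x<2m∸1 = 2x<2y⇒x<y (<-≤-trans 2x<2m∸1 (m∸n≤m (2 * m) 1))

2m∸1<2x⇒m≤x : ∀ {x m} → 2 * m ∸ 1 < 2 * x → m ≤ x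
2m∸1<2x⇒m≤x {x} {m} 2m∸1<2x = ≮⇒≥ λ x<m →
  <-asym 2m∸1<2x (∸-monoˡ-≤ 1 (subst (_≤ 2 * m) (*-suc 2 x) (*-monoʳ-≤ 2 x<m)))

∑ : {A : Set} → List A → (A → ℕ) → ℕ
∑ xs f = sum (map f xs)

syntax ∑ xs (λ x → e) = ∑[ x ∈ xs ] e

module _ {A : Set} where

  ∑-cong : ∀ (xs : List A) {f g : A → ℕ} → (∀ x → x ∈ xs → f x ≡ g x) → ∑ xs f ≡ ∑ xs g
  ∑-cong [] _ = refl
  ∑-cong (x ∷ xs) f≗g = cong₂ _+_ (f≗g x (here refl)) (∑-cong xs (λ y y∈ → f≗g y (there y∈)))

  ∑-+ : ∀ (xs : List A) (f g : A → ℕ) → ∑[ x ∈ xs ] (f x + g x) ≡ ∑ xs f + ∑ xs g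
  ∑-+ [] f g = refl
  ∑-+ (x ∷ xs) f g = trans (cong (f x + g x +_) (∑-+ xs f g)) (interchange (f x) (g x) (∑ xs f) (∑ xs g))
    where
    interchange : ∀ a b c d → (a + b) + (c + d) ≡ (a + c) + (b + d)
    interchange = solve 4 (λ a b c d → (a :+ b) :+ (c :+ d) := (a :+ c) :+ (b :+ d)) refl

  ∑-*ˡ : ∀ (xs : List A) a (f : A → ℕ) → ∑[ x ∈ xs ] (a * f x) ≡ a * ∑ xs f
  ∑-*ˡ [] a f = sym (*-zeroʳ a)
  ∑-*ˡ (x ∷ xs) a f = trans (cong (a * f x +_) (∑-*ˡ xs a f)) (sym (*-distribˡ-+ a (f x) (∑ xs f)))

  ∑-const : ∀ (xs : List A) c → ∑[ _ ∈ xs ] c ≡ length xs * c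
  ∑-const [] c = refl
  ∑-const (x ∷ xs) c = cong (c +_) (∑-const xs c)

  ∑-zero : ∀ (xs : List A) {f : A → ℕ} → (∀ x → x ∈ xs → f x ≡ 0) → ∑ xs f ≡ 0
  ∑-zero xs f≗0 = trans (∑-cong xs f≗0) (trans (∑-const xs 0) (*-zeroʳ (length xs)))

  ∑-filterᵇ : ∀ (P : A → Bool) xs (f : A → ℕ) → ∑ (filterᵇ P xs) f ≡ ∑[ x ∈ xs ] (if P x then f x else 0)
  ∑-filterᵇ P [] f = refl
  ∑-filterᵇ P (x ∷ xs) f with P x
  ... | true = cong (f x +_) (∑-filterᵇ P xs f)
  ... | false = ∑-filterᵇ P xs f

  length-filterᵇ : ∀ (P : A → Bool) xs → length (filterᵇ P xs) ≡ ∑[ x ∈ xs ] (if P x then 1 else 0)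
  length-filterᵇ P xs = begin
    length (filterᵇ P xs)            ≡⟨ sym (*-identityʳ _) ⟩
    length (filterᵇ P xs) * 1        ≡⟨ sym (∑-const (filterᵇ P xs) 1) ⟩
    ∑[ _ ∈ filterᵇ P xs ] 1          ≡⟨ ∑-filterᵇ P xs (λ _ → 1) ⟩
    ∑[ x ∈ xs ] (if P x then 1 else 0) ∎
    where open ≡-Reasoning

  ∑-indicator-unique : ∀ (xs : List A) (P : A → Bool) v {x₀} → Unique xs → x₀ ∈ xs → P x₀ ≡ true →
    (∀ x → x ∈ xs → P x ≡ true → x ≡ x₀) → ∑[ x ∈ xs ] (if P x then v else 0) ≡ v
  ∑-indicator-unique (x ∷ xs) P v (x∉xs ∷ _) (here refl) Px₀ unique rewrite Px₀ =
    trans (cong (v +_) (∑-zero xs vanish)) (+-identityʳ v)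
    where
    vanish : ∀ y → y ∈ xs → (if P y then v else 0) ≡ 0
    vanish y y∈ with P y in Py
    ... | false = refl
    ... | true = ⊥-elim (All.lookup x∉xs y∈ (sym (unique y (there y∈) Py)))
  ∑-indicator-unique (x ∷ xs) P v (x∉xs ∷ xs!) (there x₀∈) Px₀ unique with P x in Px
  ... | true = ⊥-elim (All.lookup x∉xs x₀∈ (unique x (here refl) Px))
  ... | false = ∑-indicator-unique xs P v xs! x₀∈ Px₀ (λ y y∈ → unique y (there y∈))

∑-comm : ∀ {A B : Set} (xs : List A) (ys : List B) (f : A → B → ℕ) →
  ∑[ x ∈ xs ] ∑ ys (f x) ≡ ∑[ y ∈ ys ] ∑[ x ∈ xs ] f x y
∑-comm [] ys f = sym (∑-zero ys (λ _ _ → refl))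
∑-comm (x ∷ xs) ys f =
  trans (cong (∑ ys (f x) +_) (∑-comm xs ys f)) (sym (∑-+ ys (f x) (λ y → ∑[ x′ ∈ xs ] f x′ y)))

∑∑≡diagonal+pairSum : ∀ {A : Set} (cs : List A) (G : A → A → ℕ) (h : A → ℕ) → Unique cs →
  (∀ c c′ → c ∈ cs → c′ ∈ cs → c ≢ c′ → G c c′ + G c′ c ≡ h c * h c′) →
  ∑[ c ∈ cs ] ∑ cs (G c) ≡ ∑[ c ∈ cs ] G c c + pairSum (map h cs)
∑∑≡diagonal+pairSum [] G h _ _ = refl
∑∑≡diagonal+pairSum (c ∷ cs) G h (c∉cs ∷ cs!) offDiagonal = begin
    (G c c + ∑ cs (G c)) + ∑[ x ∈ cs ] (G x c + ∑ cs (G x))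
  ≡⟨ cong ((G c c + ∑ cs (G c)) +_) (∑-+ cs (λ x → G x c) (λ x → ∑ cs (G x))) ⟩
    (G c c + ∑ cs (G c)) + (∑[ x ∈ cs ] G x c + ∑[ x ∈ cs ] ∑ cs (G x))
  ≡⟨ cong (λ z → (G c c + ∑ cs (G c)) + (∑[ x ∈ cs ] G x c + z))
       (∑∑≡diagonal+pairSum cs G h cs! (λ a b a∈ b∈ → offDiagonal a b (there a∈) (there b∈))) ⟩
    (G c c + ∑ cs (G c)) + (∑[ x ∈ cs ] G x c + (∑[ x ∈ cs ] G x x + pairSum (map h cs)))
  ≡⟨ rearrange (G c c) _ _ _ _ ⟩
    (G c c + ∑[ x ∈ cs ] G x x) + ((∑ cs (G c) + ∑[ x ∈ cs ] G x c) + pairSum (map h cs))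
  ≡⟨ cong (λ z → (G c c + ∑[ x ∈ cs ] G x x) + (z + pairSum (map h cs))) row+column ⟩
    (G c c + ∑[ x ∈ cs ] G x x) + (h c * sum (map h cs) + pairSum (map h cs)) ∎
  where
  open ≡-Reasoning
  rearrange : ∀ g b c e p → (g + b) + (c + (e + p)) ≡ (g + e) + ((b + c) + p)
  rearrange = solve 5 (λ g b c e p → (g :+ b) :+ (c :+ (e :+ p)) := (g :+ e) :+ ((b :+ c) :+ p)) refl
  row+column : ∑ cs (G c) + ∑[ x ∈ cs ] G x c ≡ h c * sum (map h cs)
  row+column = begin
    ∑ cs (G c) + ∑[ x ∈ cs ] G x c  ≡⟨ sym (∑-+ cs (G c) (λ x → G x c)) ⟩
    ∑[ x ∈ cs ] (G c x + G x c)     ≡⟨ ∑-cong cs (λ x x∈ → offDiagonal c x (here refl) (there x∈)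
                                          (λ c≡x → All.lookup c∉cs (subst (_∈ cs) (sym c≡x) x∈) refl)) ⟩
    ∑[ x ∈ cs ] (h c * h x)         ≡⟨ ∑-*ˡ cs (h c) h ⟩
    h c * sum (map h cs)            ∎

∑∑-blocks : ∀ {A : Set} (R K : List ℕ) (cs : List A) (part : A → List ℕ) (G : ℕ → ℕ → ℕ) →
  (∀ g → ∑ R g ≡ ∑ K g + ∑[ c ∈ cs ] ∑ (part c) g) →
  ∑[ p ∈ R ] ∑ R (G p)
    ≡ (∑[ p ∈ K ] ∑ K (G p) + ∑[ c ∈ cs ] ∑[ p ∈ part c ] ∑[ q ∈ K ] (G p q + G q p))
      + ∑[ c ∈ cs ] ∑[ c′ ∈ cs ] ∑[ p ∈ part c ] ∑ (part c′) (G p)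
∑∑-blocks R K cs part G split = begin
    ∑[ p ∈ R ] ∑ R (G p)
  ≡⟨ ∑-cong R (λ p _ → split (G p)) ⟩
    ∑[ p ∈ R ] (∑ K (G p) + rest p)
  ≡⟨ split (λ p → ∑ K (G p) + rest p) ⟩
    ∑[ p ∈ K ] (∑ K (G p) + rest p) + ∑[ c ∈ cs ] ∑[ p ∈ part c ] (∑ K (G p) + rest p)
  ≡⟨ cong₂ _+_ (∑-+ K _ _) (trans (∑-cong cs (λ c _ → ∑-+ (part c) _ _)) (∑-+ cs _ _)) ⟩
    (KK + ∑ K rest) + (CK + ∑[ c ∈ cs ] ∑ (part c) rest)
  ≡⟨ cong₂ (λ u v → (KK + u) + (CK + v)) KC-swap CC-swap ⟩
    (KK + KC) + (CK + CC)
  ≡⟨ rearrange KK KC CK CC ⟩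
    (KK + (CK + KC)) + CC
  ≡⟨ cong (λ u → (KK + u) + CC) mixed ⟩
    (KK + ∑[ c ∈ cs ] ∑[ p ∈ part c ] ∑[ q ∈ K ] (G p q + G q p)) + CC ∎
  where
  open ≡-Reasoning
  rest : ℕ → ℕ
  rest p = ∑[ c ∈ cs ] ∑ (part c) (G p)
  KK KC CK CC : ℕ
  KK = ∑[ p ∈ K ] ∑ K (G p)
  KC = ∑[ c ∈ cs ] ∑[ q ∈ part c ] ∑[ p ∈ K ] G p q
  CK = ∑[ c ∈ cs ] ∑[ p ∈ part c ] ∑ K (G p)
  CC = ∑[ c ∈ cs ] ∑[ c′ ∈ cs ] ∑[ p ∈ part c ] ∑ (part c′) (G p)
  KC-swap : ∑ K rest ≡ KC
  KC-swap = trans (∑-comm K cs (λ p c → ∑ (part c) (G p))) (∑-cong cs (λ c _ → ∑-comm K (part c) G))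
  CC-swap : ∑[ c ∈ cs ] ∑ (part c) rest ≡ CC
  CC-swap = ∑-cong cs (λ c _ → ∑-comm (part c) cs (λ p c′ → ∑ (part c′) (G p)))
  rearrange : ∀ a b c d → (a + b) + (c + d) ≡ (a + (c + b)) + d
  rearrange = solve 4 (λ a b c d → (a :+ b) :+ (c :+ d) := (a :+ (c :+ b)) :+ d) refl
  mixed : CK + KC ≡ ∑[ c ∈ cs ] ∑[ p ∈ part c ] ∑[ q ∈ K ] (G p q + G q p)
  mixed = trans (sym (∑-+ cs _ _)) (∑-cong cs (λ c _ →
            trans (sym (∑-+ (part c) _ _)) (∑-cong (part c) (λ p _ → sym (∑-+ K (G p) (λ q → G q p))))))

sgn-+ : ∀ a b → sgn (a + b) ≡ sgn a *ℤ sgn b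
sgn-+ zero b = sym (ℤ.*-identityˡ (sgn b))
sgn-+ (suc a) b = trans (cong -_ (sgn-+ a b)) (ℤ.neg-distribˡ-* (sgn a) (sgn b))

productℤ-sgn : ∀ {A : Set} (cs : List A) (f : A → ℕ) → productℤ (map (sgn ∘ f) cs) ≡ sgn (∑ cs f)
productℤ-sgn [] f = refl
productℤ-sgn (c ∷ cs) f = trans (cong (sgn (f c) *ℤ_) (productℤ-sgn cs f)) (sym (sgn-+ (f c) (∑ cs f)))

∈-range⁺ : ∀ {n j} → 1 ≤ j → j ≤ n → j ∈ range n
∈-range⁺ {j = suc j} _ j<n = ∈-map⁺ suc (∈-upTo⁺ j<n)

∈-range⁻ : ∀ {n j} → j ∈ range n → 1 ≤ j × j ≤ n
∈-range⁻ j∈ with ∈-map⁻ suc j∈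
... | _ , i∈ , refl = s≤s z≤n , ∈-upTo⁻ i∈

range-sorted : ∀ n → AllPairs _<_ (range n)
range-sorted n = AllPairs.map⁺ (applyUpTo⁺₁ id n (λ i<j _ → s<s i<j))

get0-map : ∀ (f : ℕ → ℕ) xs i → i < length xs → get0 (map f xs) i ≡ f (get0 xs i)
get0-map f (x ∷ xs) zero _ = refl
get0-map f (x ∷ xs) (suc i) (s<s i<) = get0-map f xs i i<

get0-∈ : ∀ xs i → i < length xs → get0 xs i ∈ xs
get0-∈ (x ∷ xs) zero _ = here refl
get0-∈ (x ∷ xs) (suc i) (s<s i<) = there (get0-∈ xs i i<)

∈⇒get0 : ∀ {xs x} → x ∈ xs → ∃ λ i → i < length xs × get0 xs i ≡ x
∈⇒get0 (here refl) = 0 , s≤s z≤n , refl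
∈⇒get0 (there x∈) with ∈⇒get0 x∈
... | i , i< , refl = suc i , s<s i< , refl

get0-strictMono : ∀ {xs} → AllPairs _<_ xs → ∀ i j → i < j → j < length xs → get0 xs i < get0 xs j
get0-strictMono (x<xs ∷ _) zero (suc j) _ (s<s j<) = All.lookup x<xs (get0-∈ _ j j<)
get0-strictMono (_ ∷ xs↗) (suc i) (suc j) (s<s i<j) (s<s j<) = get0-strictMono xs↗ i j i<j j<

∑-via-nth : ∀ (xs : List ℕ) (h : ℕ → ℕ) → ∑ xs h ≡ ∑[ k ∈ range (length xs) ] h (nth xs k)
∑-via-nth xs h = begin
    sum (map h xs)
  ≡⟨ cong (sum ∘ map h) (sym (applyUpTo-get0 xs)) ⟩
    sum (map h (applyUpTo (get0 xs) (length xs)))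
  ≡⟨ cong sum (map-applyUpTo (get0 xs) h (length xs)) ⟩
    sum (applyUpTo (h ∘ get0 xs) (length xs))
  ≡⟨ cong sum (sym (map-upTo (h ∘ get0 xs) (length xs))) ⟩
    sum (map (h ∘ get0 xs) (upTo (length xs)))
  ≡⟨ cong sum (map-∘ (upTo (length xs))) ⟩
    ∑[ k ∈ range (length xs) ] h (nth xs k) ∎
  where
  open ≡-Reasoning
  applyUpTo-get0 : ∀ xs → applyUpTo (get0 xs) (length xs) ≡ xs
  applyUpTo-get0 [] = refl
  applyUpTo-get0 (x ∷ xs) = cong (x ∷_) (applyUpTo-get0 xs)

get0-head-∈ : ∀ {xs : List ℕ} {x} → x ∈ xs → get0 xs 0 ∈ xs
get0-head-∈ {_ ∷ _} _ = here refl

module _ {A : Set} (P : A → Bool) {xs : List A} {x : A} where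

  ∈-filterᵇ⁺ : x ∈ xs → P x ≡ true → x ∈ filterᵇ P xs
  ∈-filterᵇ⁺ x∈ Px = ∈-filter⁺ (T? ∘ P) x∈ (Equivalence.from T-≡ Px)

  ∈-filterᵇ⁻ : x ∈ filterᵇ P xs → x ∈ xs × P x ≡ true
  ∈-filterᵇ⁻ x∈ = let (x∈xs , Px) = ∈-filter⁻ (T? ∘ P) x∈ in x∈xs , Equivalence.to T-≡ Px

sorted-≡ : ∀ {xs ys : List ℕ} → AllPairs _<_ xs → AllPairs _<_ ys →
  (∀ z → z ∈ xs → z ∈ ys) → (∀ z → z ∈ ys → z ∈ xs) → xs ≡ ys
sorted-≡ {[]} {[]} _ _ _ _ = refl
sorted-≡ {[]} {y ∷ _} _ _ _ ys⊆ with () ← ys⊆ y (here refl)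
sorted-≡ {x ∷ _} {[]} _ _ xs⊆ _ with () ← xs⊆ x (here refl)
sorted-≡ {x ∷ xs} {y ∷ ys} (x<xs ∷ xs↗) (y<ys ∷ ys↗) xs⊆ ys⊆ =
  cong₂ _∷_ x≡y (sorted-≡ xs↗ ys↗ (λ z z∈ → tail (xs⊆ z (there z∈)) (All.lookup x<xs z∈) x≡y)
                                  (λ z z∈ → tail (ys⊆ z (there z∈)) (All.lookup y<ys z∈) (sym x≡y)))
  where
  x≡y : x ≡ y
  x≡y with xs⊆ x (here refl) | ys⊆ y (here refl)
  ... | here x≡y | _ = x≡y
  ... | _ | here y≡x = sym y≡x
  ... | there x∈ | there y∈ = ⊥-elim (<-asym (All.lookup y<ys x∈) (All.lookup x<xs y∈))
  tail : ∀ {u v z} {us : List ℕ} → z ∈ v ∷ us → u < z → u ≡ v → z ∈ us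
  tail (here refl) u<z refl = ⊥-elim (<-irrefl refl u<z)
  tail (there z∈) _ _ = z∈

locate-between : ∀ (g : ℕ → ℕ) j N → g 0 < j → j < g N → (∀ k → k ≤ N → g k ≢ j) →
  ∃ λ l → 1 ≤ l × l ≤ N × g (l ∸ 1) < j × j < g l
locate-between g j zero g0<j j<g0 _ = ⊥-elim (<-asym g0<j j<g0)
locate-between g j (suc N) g0<j j<gN+1 g≢j with j <? g N
... | yes j<gN = let (l , 1≤l , l≤N , below , above) = locate-between g j N g0<j j<gN (λ k k≤N → g≢j k (m≤n⇒m≤1+n k≤N))
                 in l , 1≤l , m≤n⇒m≤1+n l≤N , below , above
... | no j≮gN = suc N , s≤s z≤n , ≤-refl , ≤∧≢⇒< (≮⇒≥ j≮gN) (g≢j N (n≤1+n N)) , j<gN+1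

MapsInto : ℕ → (ℕ → ℕ) → Set
MapsInto N f = ∀ k → 1 ≤ k → k ≤ N → 1 ≤ f k × f k ≤ N

InjectiveOn : ℕ → (ℕ → ℕ) → Set
InjectiveOn N f = ∀ i j → 1 ≤ i → i ≤ N → 1 ≤ j → j ≤ N → f i ≡ f j → i ≡ j

HitsAll : ℕ → (ℕ → ℕ) → Set
HitsAll N f = ∀ m → 1 ≤ m → m ≤ N → ∃ λ k → 1 ≤ k × k ≤ N × f k ≡ m

injective⇒surjective : ∀ N f → MapsInto N f → InjectiveOn N f → HitsAll N f
injective⇒surjective zero f _ _ m 1≤m m≤0 = ⊥-elim (<⇒≱ 1≤m m≤0)
injective⇒surjective (suc N) f into inj m 1≤m m≤N+1 = preimage
  where
  top t : ℕ
  top = suc N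
  t = f top

  1≤top : 1 ≤ top
  1≤top = s≤s z≤n

  t∈ : 1 ≤ t × t ≤ top
  t∈ = into top 1≤top ≤-refl

  -- g redirects the value top to t, turning f into a self-map of {1, …, N}.
  g : ℕ → ℕ
  g k = if f k ≡ᵇ top then t else f k

  g-top : ∀ {k} → f k ≡ top → g k ≡ t
  g-top fk≡top rewrite ≡ᵇ-true⁺ fk≡top = refl

  g-other : ∀ {k} → f k ≢ top → g k ≡ f k
  g-other fk≢top rewrite ≡ᵇ-false⁺ fk≢top = refl

  f≢t : ∀ k → 1 ≤ k → k ≤ N → f k ≢ t
  f≢t k 1≤k k≤N fk≡t = <-irrefl (inj k top 1≤k (m≤n⇒m≤1+n k≤N) 1≤top ≤-refl fk≡t) (s≤s k≤N)

  below-top : ∀ {v} → v ≤ top → v ≢ top → v ≤ N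
  below-top v≤ v≢ = ≤-pred (≤∧≢⇒< v≤ v≢)

  g-into : MapsInto N g
  g-into k 1≤k k≤N with f k ≟ top
  ... | yes fk≡top rewrite g-top fk≡top =
    proj₁ t∈ , below-top (proj₂ t∈) (λ t≡top → f≢t k 1≤k k≤N (trans fk≡top (sym t≡top)))
  ... | no fk≢top rewrite g-other fk≢top =
    let (1≤fk , fk≤) = into k 1≤k (m≤n⇒m≤1+n k≤N) in 1≤fk , below-top fk≤ fk≢top

  g-inj : InjectiveOn N g
  g-inj i j 1≤i i≤N 1≤j j≤N gi≡gj with f i ≟ top | f j ≟ top
  ... | yes fi≡ | yes fj≡ = inj i j 1≤i (m≤n⇒m≤1+n i≤N) 1≤j (m≤n⇒m≤1+n j≤N) (trans fi≡ (sym fj≡))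
  ... | yes fi≡ | no fj≢ = ⊥-elim (f≢t j 1≤j j≤N (trans (sym (g-other fj≢)) (trans (sym gi≡gj) (g-top fi≡))))
  ... | no fi≢ | yes fj≡ = ⊥-elim (f≢t i 1≤i i≤N (trans (sym (g-other fi≢)) (trans gi≡gj (g-top fj≡))))
  ... | no fi≢ | no fj≢ =
    inj i j 1≤i (m≤n⇒m≤1+n i≤N) 1≤j (m≤n⇒m≤1+n j≤N) (trans (sym (g-other fi≢)) (trans gi≡gj (g-other fj≢)))

  hit : HitsAll N g
  hit = injective⇒surjective N g g-into g-inj

  preimage : ∃ λ k → 1 ≤ k × k ≤ top × f k ≡ m
  preimage with t ≟ m | m ≟ top
  ... | yes t≡m | _ = top , 1≤top , ≤-refl , t≡m
  ... | no t≢m | no m≢top with hit m 1≤m (below-top m≤N+1 m≢top)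
  ...   | k , 1≤k , k≤N , gk≡m with f k ≟ top
  ...     | yes fk≡top = ⊥-elim (t≢m (trans (sym (g-top fk≡top)) gk≡m))
  ...     | no fk≢top = k , 1≤k , m≤n⇒m≤1+n k≤N , trans (sym (g-other fk≢top)) gk≡m
  preimage | no t≢m | yes refl with hit t (proj₁ t∈) (below-top (proj₂ t∈) t≢m)
  ... | k , 1≤k , k≤N , gk≡t with f k ≟ top
  ...   | yes fk≡top = k , 1≤k , m≤n⇒m≤1+n k≤N , fk≡top
  ...   | no fk≢top = ⊥-elim (f≢t k 1≤k k≤N (trans (sym (g-other fk≢top)) gk≡t))

inversionAt : (ℕ → ℕ) → ℕ → ℕ → ℕ
inversionAt π p q = if (p <ᵇ q) ∧ (π q <ᵇ π p) then 1 else 0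

inversionAt-pair : ∀ π {p q} → p < q → π q < π p → inversionAt π p q + inversionAt π q p ≡ 1
inversionAt-pair π {p} {q} p<q πq<πp rewrite <ᵇ-true⁺ p<q | <ᵇ-true⁺ πq<πp | <ᵇ-false⁺ (<-asym p<q) = refl

countBelow : ℕ → List ℕ → ℕ
countBelow v xs = length (filter (_<? v) xs)

countBelow-map : ∀ (π : ℕ → ℕ) v ps → countBelow v (map π ps) ≡ ∑[ q ∈ ps ] (if π q <ᵇ v then 1 else 0)
countBelow-map π v [] = refl
countBelow-map π v (q ∷ ps) with π q <ᵇ v
... | true = cong suc (countBelow-map π v ps)
... | false = countBelow-map π v ps

inversions-map : ∀ (π : ℕ → ℕ) ps → AllPairs _<_ ps → inversions (map π ps) ≡ ∑[ p ∈ ps ] ∑ ps (inversionAt π p)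
inversions-map π [] _ = refl
inversions-map π (p ∷ ps) (p<ps ∷ ps↗) = begin
    countBelow (π p) (map π ps) + inversions (map π ps)
  ≡⟨ cong₂ _+_ (trans (countBelow-map π (π p) ps) (∑-cong ps later)) (inversions-map π ps ps↗) ⟩
    ∑ ps (inversionAt π p) + ∑[ x ∈ ps ] ∑ ps (inversionAt π x)
  ≡⟨ cong₂ _+_ (sym diagonal) (sym (trans (∑-+ ps (λ x → inversionAt π x p) (λ x → ∑ ps (inversionAt π x)))
                                           (cong (_+ ∑[ x ∈ ps ] ∑ ps (inversionAt π x)) (∑-zero ps earlier)))) ⟩
    (inversionAt π p p + ∑ ps (inversionAt π p)) + ∑[ x ∈ ps ] (inversionAt π x p + ∑ ps (inversionAt π x)) ∎
  where
  open ≡-Reasoning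
  diagonal : inversionAt π p p + ∑ ps (inversionAt π p) ≡ ∑ ps (inversionAt π p)
  diagonal rewrite <ᵇ-irrefl p = refl
  later : ∀ q → q ∈ ps → (if π q <ᵇ π p then 1 else 0) ≡ inversionAt π p q
  later q q∈ rewrite <ᵇ-true⁺ (All.lookup p<ps q∈) = refl
  earlier : ∀ q → q ∈ ps → inversionAt π q p ≡ 0
  earlier q q∈ rewrite <ᵇ-false⁺ (<-asym (All.lookup p<ps q∈)) = refl

-- With this, shape xs is definitionally map (rank xs) xs.
rank : List ℕ → ℕ → ℕ
rank xs x = suc (countBelow x xs)

countBelow-mono : ∀ {v w} xs → v ≤ w → countBelow v xs ≤ countBelow w xs
countBelow-mono [] _ = z≤n
countBelow-mono {v} {w} (x ∷ xs) v≤w with x <ᵇ v in x<v | x <ᵇ w in x<w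
... | true | true = s≤s (countBelow-mono xs v≤w)
... | true | false = ⊥-elim (<ᵇ-false⁻ x<w (<-≤-trans (<ᵇ-true⁻ x<v) v≤w))
... | false | true = m≤n⇒m≤1+n (countBelow-mono xs v≤w)
... | false | false = countBelow-mono xs v≤w

countBelow-strictMono : ∀ {v w} xs → v < w → v ∈ xs → countBelow v xs < countBelow w xs
countBelow-strictMono {v} {w} (x ∷ xs) v<w v∈ with x <ᵇ v in x<v | x <ᵇ w in x<w | v∈
... | true | _ | here refl = ⊥-elim (<-irrefl refl (<ᵇ-true⁻ {v} x<v))
... | true | true | there v∈xs = s≤s (countBelow-strictMono xs v<w v∈xs)
... | true | false | there _ = ⊥-elim (<ᵇ-false⁻ x<w (<-trans (<ᵇ-true⁻ x<v) v<w))
... | false | true | here refl = s≤s (countBelow-mono xs (<⇒≤ v<w))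
... | false | true | there v∈xs = m<n⇒m<1+n (countBelow-strictMono xs v<w v∈xs)
... | false | false | here refl = ⊥-elim (<ᵇ-false⁻ x<w v<w)
... | false | false | there v∈xs = countBelow-strictMono xs v<w v∈xs

countBelow<length : ∀ {v} xs → v ∈ xs → countBelow v xs < length xs
countBelow<length {v} (x ∷ xs) v∈ with x <ᵇ v in x<v | v∈
... | true | here refl = ⊥-elim (<-irrefl refl (<ᵇ-true⁻ {v} x<v))
... | true | there v∈xs = s≤s (countBelow<length xs v∈xs)
... | false | here refl = s≤s (length-filter (_<? v) xs)
... | false | there v∈xs = m<n⇒m<1+n (countBelow<length xs v∈xs)

rank-strictMono : ∀ xs {x y} → x ∈ xs → x < y → rank xs x < rank xs y
rank-strictMono xs x∈ x<y = s<s (countBelow-strictMono xs x<y x∈)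

rank-cancel-< : ∀ xs {x y} → x ∈ xs → rank xs x < rank xs y → x < y
rank-cancel-< xs {x} {y} x∈ rx<ry with x <? y
... | yes x<y = x<y
... | no x≮y = ⊥-elim (<⇒≱ rx<ry (s≤s (countBelow-mono xs (≮⇒≥ x≮y))))

rank≤length : ∀ xs {x} → x ∈ xs → rank xs x ≤ length xs
rank≤length xs x∈ = countBelow<length xs x∈

inversions-shape : ∀ xs → inversions (shape xs) ≡ inversions xs
inversions-shape xs = inversions-rank xs (λ _ z∈ → z∈)
  where
  below-rank : ∀ y zs → (∀ z → z ∈ zs → z ∈ xs) →
    countBelow (rank xs y) (map (rank xs) zs) ≡ countBelow y zs
  below-rank y [] _ = refl
  below-rank y (z ∷ zs) zs⊆ with z <ᵇ y in z<y | rank xs z <ᵇ rank xs y in rz<ry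
  ... | true | true = cong suc (below-rank y zs (λ w w∈ → zs⊆ w (there w∈)))
  ... | false | false = below-rank y zs (λ w w∈ → zs⊆ w (there w∈))
  ... | true | false = ⊥-elim (<ᵇ-false⁻ rz<ry (rank-strictMono xs (zs⊆ z (here refl)) (<ᵇ-true⁻ z<y)))
  ... | false | true = ⊥-elim (<ᵇ-false⁻ z<y (rank-cancel-< xs (zs⊆ z (here refl)) (<ᵇ-true⁻ rz<ry)))
  inversions-rank : ∀ ys → (∀ y → y ∈ ys → y ∈ xs) → inversions (map (rank xs) ys) ≡ inversions ys
  inversions-rank [] _ = refl
  inversions-rank (y ∷ ys) ys⊆ =
    cong₂ _+_ (below-rank y ys (λ z z∈ → ys⊆ z (there z∈))) (inversions-rank ys (λ z z∈ → ys⊆ z (there z∈)))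

module CellDecomposition (n : ℕ) (π : ℕ → ℕ) (n≥1 : 1 ≤ n) (perm : IsPerm n π)
                         (ks : List ℕ) (kernel : IsKernelPositions n π ks) where

  open Kernel n π ks

  π-range : MapsInto n π
  π-range = proj₁ perm

  π-injective : InjectiveOn n π
  π-injective = proj₂ perm

  ks-sorted : AllPairs _<_ ks
  ks-sorted = proj₁ kernel

  ∈ks⇒kernel : ∀ {j} → j ∈ ks → InKernel n π j
  ∈ks⇒kernel {j} = proj₁ (proj₂ kernel j)

  kernel⇒∈ks : ∀ {j} → InKernel n π j → j ∈ ks
  kernel⇒∈ks {j} = proj₂ (proj₂ kernel j)

  ks-range : ∀ {j} → j ∈ ks → 1 ≤ j × j ≤ n
  ks-range j∈ = let (1≤j , j≤n , _) = ∈ks⇒kernel j∈ in 1≤j , j≤n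

  position-of-n : ∃ λ p → 1 ≤ p × p ≤ n × π p ≡ n
  position-of-n = injective⇒surjective n π π-range π-injective n n≥1 ≤-refl

  pₙ : ℕ
  pₙ = proj₁ position-of-n

  pₙ-kernel : InKernel n π pₙ
  pₙ-kernel = let (_ , 1≤p , p≤n , πp≡n) = position-of-n in 1≤p , p≤n , pₙ , 1≤p , p≤n , πp≡n , ε

  ipos-inner : ∀ k → k < s → ipos (suc k) ≡ get0 ks k
  ipos-inner k k<s rewrite ≤ᵇ-true⁺ k<s = refl

  ipos-last : ipos (suc s) ≡ suc n
  ipos-last rewrite ≤ᵇ-false⁺ (n≮n s) = refl

  ipos-∈ks : ∀ k → 1 ≤ k → k ≤ s → ipos k ∈ ks
  ipos-∈ks (suc k) _ k<s rewrite ipos-inner k k<s = get0-∈ ks k k<s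

  ipos-range : ∀ k → 1 ≤ k → k ≤ s → 1 ≤ ipos k × ipos k ≤ n
  ipos-range k 1≤k k≤s = ks-range (ipos-∈ks k 1≤k k≤s)

  ipos-strictMono : ∀ a b → a < b → b ≤ suc s → ipos a < ipos b
  ipos-strictMono zero (suc b) _ b≤ with m≤n⇒m<n∨m≡n (≤-pred b≤)
  ... | inj₁ b<s = proj₁ (ipos-range (suc b) (s≤s z≤n) b<s)
  ... | inj₂ refl rewrite ipos-last = s≤s z≤n
  ipos-strictMono (suc a) (suc b) (s<s a<b) b≤ with m≤n⇒m<n∨m≡n (≤-pred b≤)
  ... | inj₁ b<s rewrite ipos-inner a (<-trans a<b b<s) | ipos-inner b b<s = get0-strictMono ks-sorted a b a<b b<s
  ... | inj₂ refl rewrite ipos-last = s≤s (proj₂ (ipos-range (suc a) (s≤s z≤n) a<b))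

  ipos-mono : ∀ a b → a ≤ b → b ≤ suc s → ipos a ≤ ipos b
  ipos-mono a b a≤b b≤ with m≤n⇒m<n∨m≡n a≤b
  ... | inj₁ a<b = <⇒≤ (ipos-strictMono a b a<b b≤)
  ... | inj₂ refl = ≤-refl

  ipos-cancel-< : ∀ a b → a ≤ suc s → ipos a < ipos b → a < b
  ipos-cancel-< a b a≤ ia<ib with <-cmp a b
  ... | tri< a<b _ _ = a<b
  ... | tri≈ _ refl _ = ⊥-elim (<-irrefl refl ia<ib)
  ... | tri> _ _ b<a = ⊥-elim (<-asym ia<ib (ipos-strictMono b a b<a a≤))

  ipos≤ipos-pred : ∀ {l l′} → l < l′ → l′ ≤ suc s → ipos l ≤ ipos (l′ ∸ 1)
  ipos≤ipos-pred {l} {l′} l<l′ l′≤ = ipos-mono l (l′ ∸ 1) (m<n⇒m≤n∸1 l<l′) (≤-trans (m∸n≤m l′ 1) l′≤)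

  kval : ℕ → ℕ
  kval k = π (ipos k)

  kvals : List ℕ
  kvals = map π ks

  kval-∈ : ∀ k → 1 ≤ k → k ≤ s → kval k ∈ kvals
  kval-∈ k 1≤k k≤s = ∈-map⁺ π (ipos-∈ks k 1≤k k≤s)

  ρ≡rank : ∀ k → 1 ≤ k → k ≤ s → ρ k ≡ rank kvals (kval k)
  ρ≡rank (suc k) _ k<s rewrite ipos-inner k k<s =
    trans (get0-map (rank kvals) kvals k (subst (k <_) (sym (length-map π ks)) k<s))
          (cong (rank kvals) (get0-map π ks k k<s))

  ρ-range : ∀ k → 1 ≤ k → k ≤ s → 1 ≤ ρ k × ρ k ≤ s
  ρ-range k 1≤k k≤s rewrite ρ≡rank k 1≤k k≤s =
    s≤s z≤n , subst (rank kvals (kval k) ≤_) (length-map π ks) (rank≤length kvals (kval-∈ k 1≤k k≤s))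

  kval-injective : InjectiveOn s kval
  kval-injective a b 1≤a a≤s 1≤b b≤s va≡vb = by-cases (<-cmp a b)
    where
    ia≡ib : ipos a ≡ ipos b
    ia≡ib = π-injective _ _ (proj₁ (ipos-range a 1≤a a≤s)) (proj₂ (ipos-range a 1≤a a≤s))
                            (proj₁ (ipos-range b 1≤b b≤s)) (proj₂ (ipos-range b 1≤b b≤s)) va≡vb
    by-cases : Tri (a < b) (a ≡ b) (b < a) → a ≡ b
    by-cases (tri< a<b _ _) = ⊥-elim (<-irrefl ia≡ib (ipos-strictMono a b a<b (m≤n⇒m≤1+n b≤s)))
    by-cases (tri≈ _ a≡b _) = a≡b
    by-cases (tri> _ _ b<a) = ⊥-elim (<-irrefl (sym ia≡ib) (ipos-strictMono b a b<a (m≤n⇒m≤1+n a≤s)))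

  module _ {a b : ℕ} (1≤a : 1 ≤ a) (a≤s : a ≤ s) (1≤b : 1 ≤ b) (b≤s : b ≤ s) where

    ρ-strictMono : kval a < kval b → ρ a < ρ b
    ρ-strictMono va<vb rewrite ρ≡rank a 1≤a a≤s | ρ≡rank b 1≤b b≤s = rank-strictMono kvals (kval-∈ a 1≤a a≤s) va<vb

    ρ-cancel-< : ρ a < ρ b → kval a < kval b
    ρ-cancel-< ρa<ρb rewrite ρ≡rank a 1≤a a≤s | ρ≡rank b 1≤b b≤s = rank-cancel-< kvals (kval-∈ a 1≤a a≤s) ρa<ρb

  ρ-cancel-≤ : ∀ {a b} → 1 ≤ a → a ≤ s → 1 ≤ b → b ≤ s → ρ a ≤ ρ b → kval a ≤ kval b
  ρ-cancel-≤ 1≤a a≤s 1≤b b≤s ρa≤ρb = ≮⇒≥ (λ vb<va → <⇒≱ (ρ-strictMono 1≤b b≤s 1≤a a≤s vb<va) ρa≤ρb)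

  ρ-injective : InjectiveOn s ρ
  ρ-injective a b 1≤a a≤s 1≤b b≤s ρa≡ρb = kval-injective a b 1≤a a≤s 1≤b b≤s
    (≤-antisym (ρ-cancel-≤ 1≤a a≤s 1≤b b≤s (≤-reflexive ρa≡ρb)) (ρ-cancel-≤ 1≤b b≤s 1≤a a≤s (≤-reflexive (sym ρa≡ρb))))

  ρinv-inverse : ∀ m → 1 ≤ m → m ≤ s → (1 ≤ ρinv m × ρinv m ≤ s) × ρ (ρinv m) ≡ m
  ρinv-inverse m 1≤m m≤s with injective⇒surjective s ρ ρ-range ρ-injective m 1≤m m≤s
  ... | k , 1≤k , k≤s , ρk≡m = ∈-range⁻ (proj₁ head) , ≡ᵇ-true⁻ (proj₂ head)
    where
    P : ℕ → Bool
    P k = ρ k ≡ᵇ m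
    k∈ : k ∈ filterᵇ P (range s)
    k∈ = ∈-filterᵇ⁺ P (∈-range⁺ 1≤k k≤s) (≡ᵇ-true⁺ ρk≡m)
    head : get0 (filterᵇ P (range s)) 0 ∈ range s × P (get0 (filterᵇ P (range s)) 0) ≡ true
    head = ∈-filterᵇ⁻ P (get0-head-∈ k∈)

  up-mono : ∀ a b → 1 ≤ a → a ≤ b → b ≤ s → up a ≤ up b
  up-mono a b 1≤a a≤b b≤s =
    let ((1≤ia , ia≤s) , ρia≡a) = ρinv-inverse a 1≤a (≤-trans a≤b b≤s)
        ((1≤ib , ib≤s) , ρib≡b) = ρinv-inverse b (≤-trans 1≤a a≤b) b≤s
    in ρ-cancel-≤ 1≤ia ia≤s 1≤ib ib≤s (subst₂ _≤_ (sym ρia≡a) (sym ρib≡b) a≤b)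

  kval≡up∘ρ : ∀ k → 1 ≤ k → k ≤ s → kval k ≡ up (ρ k)
  kval≡up∘ρ k 1≤k k≤s =
    let (1≤ρk , ρk≤s) = ρ-range k 1≤k k≤s
        ((1≤i , i≤s) , ρi≡ρk) = ρinv-inverse (ρ k) 1≤ρk ρk≤s
    in cong kval (sym (ρ-injective (ρinv (ρ k)) k 1≤i i≤s 1≤k k≤s ρi≡ρk))

  low≡up-pred : ∀ m → 2 ≤ m → low m ≡ up (m ∸ 1)
  low≡up-pred (suc zero) (s≤s ())
  low≡up-pred (suc (suc m)) _ = refl

  kval-above-row : ∀ k m {x} → 1 ≤ k → k ≤ s → 1 ≤ m → x < up m → m ≤ ρ k → x < kval k
  kval-above-row k m 1≤k k≤s 1≤m x<up m≤ρk =
    <-≤-trans x<up (subst (up m ≤_) (sym (kval≡up∘ρ k 1≤k k≤s)) (up-mono m (ρ k) 1≤m m≤ρk (proj₂ (ρ-range k 1≤k k≤s))))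

  kval-below-row : ∀ k m {x} → 1 ≤ k → k ≤ s → m ≤ s → low m < x → ρ k < m → kval k < x
  kval-below-row k (suc zero) 1≤k k≤s _ _ ρk<1 = ⊥-elim (<⇒≱ ρk<1 (proj₁ (ρ-range k 1≤k k≤s)))
  kval-below-row k (suc (suc m)) 1≤k k≤s m≤s low<x (s≤s ρk≤) =
    ≤-<-trans (subst (_≤ up (suc m)) (sym (kval≡up∘ρ k 1≤k k≤s))
                (up-mono (ρ k) (suc m) (proj₁ (ρ-range k 1≤k k≤s)) ρk≤ (≤-trans (n≤1+n _) m≤s)))
              low<x

  kernel-index : ∀ {j} → j ∈ ks → ∃ λ k → 1 ≤ k × k ≤ s × ipos k ≡ j
  kernel-index j∈ with ∈⇒get0 j∈
  ... | i , i<s , refl = suc i , s≤s z≤n , i<s , ipos-inner i i<s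

  s≥1 : 1 ≤ s
  s≥1 = let (_ , 1≤k , k≤s , _) = kernel-index (kernel⇒∈ks pₙ-kernel) in ≤-trans 1≤k k≤s

  n≤up-s : n ≤ up s
  n≤up-s =
    let (k , 1≤k , k≤s , ik≡pₙ) = kernel-index (kernel⇒∈ks pₙ-kernel)
        (_ , _ , _ , πpₙ≡n) = position-of-n
        kval≡n : kval k ≡ n
        kval≡n = trans (cong π ik≡pₙ) πpₙ≡n
    in subst (_≤ up s) (trans (sym (kval≡up∘ρ k 1≤k k≤s)) kval≡n)
         (up-mono (ρ k) s (proj₁ (ρ-range k 1≤k k≤s)) (proj₂ (ρ-range k 1≤k k≤s)) ≤-refl)

  NonKernel : ℕ → Set
  NonKernel j = 1 ≤ j × j ≤ n × ¬ InKernel n π j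

  nonKernel-≢ipos : ∀ {j} → NonKernel j → ∀ k → 1 ≤ k → k ≤ s → ipos k ≢ j
  nonKernel-≢ipos (_ , _ , ∉kernel) k 1≤k k≤s ik≡j = ∉kernel (∈ks⇒kernel (subst (_∈ ks) ik≡j (ipos-∈ks k 1≤k k≤s)))

  nonKernel-≢kval : ∀ {j} → NonKernel j → ∀ k → 1 ≤ k → k ≤ s → kval k ≢ π j
  nonKernel-≢kval nkj@(1≤j , j≤n , _) k 1≤k k≤s vk≡πj = nonKernel-≢ipos nkj k 1≤k k≤s
    (π-injective _ _ (proj₁ (ipos-range k 1≤k k≤s)) (proj₂ (ipos-range k 1≤k k≤s)) 1≤j j≤n vk≡πj)

  nonKernel<n : ∀ {j} → NonKernel j → π j < n
  nonKernel<n {j} (1≤j , j≤n , ∉kernel) = ≤∧≢⇒< (proj₂ (π-range j 1≤j j≤n)) λ πj≡n →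
    let (_ , 1≤p , p≤n , πp≡n) = position-of-n
    in ∉kernel (subst (InKernel n π) (π-injective pₙ j 1≤p p≤n 1≤j j≤n (trans πp≡n (sym πj≡n))) pₙ-kernel)

  IsCell : ℕ → ℕ → Set
  IsCell m l = (1 ≤ m × m ≤ s) × (1 ≤ l × l ≤ suc s)

  InCell : ℕ → ℕ → ℕ → Set
  InCell m l j = ipos (l ∸ 1) < j × j < ipos l × low m < π j × π j < up m

  inCell-true⁻ : ∀ m l j → inCell m l j ≡ true → InCell m l j
  inCell-true⁻ m l j holds =
    let (a , rest) = ∧-true holds ; (b , rest′) = ∧-true rest ; (c , d) = ∧-true rest′
    in <ᵇ-true⁻ a , <ᵇ-true⁻ b , <ᵇ-true⁻ c , <ᵇ-true⁻ d

  inCell-true⁺ : ∀ m l j → InCell m l j → inCell m l j ≡ true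
  inCell-true⁺ m l j (a , b , c , d) rewrite <ᵇ-true⁺ a | <ᵇ-true⁺ b | <ᵇ-true⁺ c | <ᵇ-true⁺ d = refl

  cell-exists : ∀ {j} → NonKernel j → ∃ λ m → ∃ λ l → IsCell m l × InCell m l j
  cell-exists {j} nkj@(1≤j , j≤n , _) =
    let (l , 1≤l , l≤ , i<j , j<i) = locate-between ipos j (suc s) 1≤j j<last ipos≢j
        (m , 1≤m , m≤s , lo<πj , πj<up) = locate-between rowTop (π j) s (proj₁ (π-range j 1≤j j≤n)) πj<top rowTop≢πj
    in m , l , ((1≤m , m≤s) , (1≤l , l≤)) , i<j , j<i , low-bound m 1≤m lo<πj , up-bound m 1≤m πj<up
    where
    j<last : j < ipos (suc s)
    j<last = subst (j <_) (sym ipos-last) (s≤s j≤n)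
    ipos≢j : ∀ k → k ≤ suc s → ipos k ≢ j
    ipos≢j zero _ 0≡j = <-irrefl 0≡j 1≤j
    ipos≢j (suc k) k<s+1 ik≡j with m≤n⇒m<n∨m≡n (≤-pred k<s+1)
    ... | inj₁ k<s = nonKernel-≢ipos nkj (suc k) (s≤s z≤n) k<s ik≡j
    ... | inj₂ refl = <-irrefl (sym ik≡j) j<last
    rowTop : ℕ → ℕ
    rowTop zero = 0
    rowTop (suc m) = up (suc m)
    rowTop≡up : ∀ m → 1 ≤ m → rowTop m ≡ up m
    rowTop≡up (suc m) _ = refl
    πj<top : π j < rowTop s
    πj<top = subst (π j <_) (sym (rowTop≡up s s≥1)) (<-≤-trans (nonKernel<n nkj) n≤up-s)
    rowTop≢πj : ∀ m → m ≤ s → rowTop m ≢ π j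
    rowTop≢πj zero _ 0≡πj = <-irrefl 0≡πj (proj₁ (π-range j 1≤j j≤n))
    rowTop≢πj (suc m) m<s = let ((1≤i , i≤s) , _) = ρinv-inverse (suc m) (s≤s z≤n) m<s
                            in nonKernel-≢kval nkj (ρinv (suc m)) 1≤i i≤s
    low-bound : ∀ m → 1 ≤ m → rowTop (m ∸ 1) < π j → low m < π j
    low-bound (suc zero) _ lt = lt
    low-bound (suc (suc m)) _ lt = lt
    up-bound : ∀ m → 1 ≤ m → π j < rowTop m → π j < up m
    up-bound (suc m) _ lt = lt

  cell-unique : ∀ {m l m′ l′ j} → IsCell m l → IsCell m′ l′ → InCell m l j → InCell m′ l′ j → m ≡ m′ × l ≡ l′
  cell-unique {m} {l} {m′} {l′} {j} ((1≤m , m≤s) , (_ , l≤)) ((1≤m′ , m′≤s) , (_ , l′≤))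
              (i<j , j<i , lo<πj , πj<up) (i<j′ , j<i′ , lo<πj′ , πj<up′) = same-row , same-column
    where
    columns-apart : ∀ {l l′} → l′ ≤ suc s → l < l′ → j < ipos l → ipos (l′ ∸ 1) < j → ⊥
    columns-apart {l} {l′} l′≤ l<l′ j<il il′<j = <-asym j<il (≤-<-trans (ipos≤ipos-pred l<l′ l′≤) il′<j)
    same-column : l ≡ l′
    same-column with <-cmp l l′
    ... | tri< l<l′ _ _ = ⊥-elim (columns-apart l′≤ l<l′ j<i i<j′)
    ... | tri≈ _ l≡l′ _ = l≡l′
    ... | tri> _ _ l′<l = ⊥-elim (columns-apart l≤ l′<l j<i′ i<j)
    rows-apart : ∀ {m m′} → 1 ≤ m → m′ ≤ s → m < m′ → π j < up m → low m′ < π j → ⊥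
    rows-apart {m} {suc m′} 1≤m m′≤s (s<s m≤) πj<up lo<πj =
      <-asym πj<up (≤-<-trans (up-mono m m′ 1≤m m≤ (≤-trans (n≤1+n m′) m′≤s))
        (subst (_< π j) (low≡up-pred (suc m′) (s≤s (≤-trans 1≤m m≤))) lo<πj))
    same-row : m ≡ m′
    same-row with <-cmp m m′
    ... | tri< m<m′ _ _ = ⊥-elim (rows-apart 1≤m m′≤s m<m′ πj<up lo<πj′)
    ... | tri≈ _ m≡m′ _ = m≡m′
    ... | tri> _ _ m′<m = ⊥-elim (rows-apart 1≤m′ m≤s m′<m πj<up′ lo<πj)

  kernel-not-in-cell : ∀ {m l k} → 1 ≤ l → l ≤ suc s → 1 ≤ k → k ≤ s → ¬ InCell m l (ipos k)
  kernel-not-in-cell {l = suc l} {k} _ l≤ _ k≤s (il<ik , ik<il′ , _) =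
    <-irrefl refl (<-≤-trans (ipos-cancel-< l k (≤-trans (n≤1+n l) l≤) il<ik)
                             (≤-pred (ipos-cancel-< k (suc l) (m≤n⇒m≤1+n k≤s) ik<il′)))

  kernel-extend : ∀ {w a} → InKernel n π w → Adj n π w a → 1 ≤ a → a ≤ n → InKernel n π a
  kernel-extend (_ , _ , p , 1≤p , p≤n , πp≡n , path) adj 1≤a a≤n = 1≤a , a≤n , p , 1≤p , p≤n , πp≡n , (path ◅◅ (adj ◅ ε))

  occurrence-range : ∀ {a x y z} → Occ132 n π x y z → In3 a x y z → 1 ≤ a × a ≤ n
  occurrence-range (1≤x , x<y , y<z , z≤max , _) (inj₁ refl) = 1≤x , <⇒≤ (<-trans x<y (<-≤-trans y<z z≤max))
  occurrence-range (1≤x , x<y , y<z , z≤max , _) (inj₂ (inj₁ refl)) = ≤-trans 1≤x (<⇒≤ x<y) , <⇒≤ (<-≤-trans y<z z≤max)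
  occurrence-range (1≤x , x<y , y<z , z≤max , _) (inj₂ (inj₂ refl)) = ≤-trans 1≤x (<⇒≤ (<-trans x<y y<z)) , z≤max

  first : ∀ {x y z} → In3 x x y z
  first = inj₁ refl

  second : ∀ {x y z} → In3 y x y z
  second = inj₂ (inj₁ refl)

  third : ∀ {x y z} → In3 z x y z
  third = inj₂ (inj₂ refl)

  no-shared-occurrence : ∀ {a w x y z} → NonKernel a → InKernel n π w → Occ132 n π x y z →
    In3 a x y z → In3 w x y z → ⊥
  no-shared-occurrence {x = x} {y} {z} (1≤a , a≤n , ∉kernel) w∈K occ a∈ w∈ =
    ∉kernel (kernel-extend w∈K (x , y , z , occ , w∈ , a∈) 1≤a a≤n)

  nonKernel-≢kernel : ∀ {a w} → NonKernel a → InKernel n π w → a ≢ w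
  nonKernel-≢kernel (_ , _ , ∉kernel) w∈K refl = ∉kernel w∈K

  nonKernel-≢kernel-value : ∀ {a w} → NonKernel a → InKernel n π w → π a ≢ π w
  nonKernel-≢kernel-value na@(1≤a , a≤n , _) w∈K@(1≤w , w≤n , _) πa≡πw =
    nonKernel-≢kernel na w∈K (π-injective _ _ 1≤a a≤n 1≤w w≤n πa≡πw)

  data Escape (x e₁ e₂ e₃ : ℕ) : Set where
    left-above : x < e₁ → π e₃ < π x → Escape x e₁ e₂ e₃
    right-below : e₂ < x → π x < π e₁ → Escape x e₁ e₂ e₃
    right-above : e₃ < x → π e₂ < π x → Escape x e₁ e₂ e₃

  escape : ∀ {x e₁ e₂ e₃} → NonKernel x → Occ132 n π e₁ e₂ e₃ →
    InKernel n π e₁ → InKernel n π e₂ → InKernel n π e₃ → Escape x e₁ e₂ e₃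
  escape {x} {e₁} {e₂} {e₃} nx (1≤e₁ , e₁<e₂ , e₂<e₃ , e₃≤n , πe₁<πe₃ , πe₃<πe₂) k₁ k₂ k₃ = by-position
    where
    1≤x = proj₁ nx
    x≤n = proj₁ (proj₂ nx)
    shares : ∀ {w p q r} → InKernel n π w → Occ132 n π p q r → In3 x p q r → In3 w p q r → ⊥
    shares = no-shared-occurrence nx
    by-position : Escape x e₁ e₂ e₃
    by-position with <-cmp x e₁
    ... | tri≈ _ x≡e₁ _ = ⊥-elim (nonKernel-≢kernel nx k₁ x≡e₁)
    ... | tri< x<e₁ _ _ with <-cmp (π x) (π e₃)
    ...   | tri< πx<πe₃ _ _ = ⊥-elim (shares k₂ (1≤x , <-trans x<e₁ e₁<e₂ , e₂<e₃ , e₃≤n , πx<πe₃ , πe₃<πe₂) first second)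
    ...   | tri≈ _ πx≡πe₃ _ = ⊥-elim (nonKernel-≢kernel-value nx k₃ πx≡πe₃)
    ...   | tri> _ _ πe₃<πx = left-above x<e₁ πe₃<πx
    by-position | tri> _ _ e₁<x with <-cmp x e₂
    ... | tri≈ _ x≡e₂ _ = ⊥-elim (nonKernel-≢kernel nx k₂ x≡e₂)
    ... | tri< x<e₂ _ _ with <-cmp (π x) (π e₃)
    ...   | tri< πx<πe₃ _ _ = ⊥-elim (shares k₂ (1≤x , x<e₂ , e₂<e₃ , e₃≤n , πx<πe₃ , πe₃<πe₂) first second)
    ...   | tri≈ _ πx≡πe₃ _ = ⊥-elim (nonKernel-≢kernel-value nx k₃ πx≡πe₃)
    ...   | tri> _ _ πe₃<πx = ⊥-elim (shares k₁ (1≤e₁ , e₁<x , <-trans x<e₂ e₂<e₃ , e₃≤n , πe₁<πe₃ , πe₃<πx) second first)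
    by-position | tri> _ _ e₁<x | tri> _ _ e₂<x with <-cmp (π x) (π e₁)
    ... | tri< πx<πe₁ _ _ = right-below e₂<x πx<πe₁
    ... | tri≈ _ πx≡πe₁ _ = ⊥-elim (nonKernel-≢kernel-value nx k₁ πx≡πe₁)
    ... | tri> _ _ πe₁<πx with <-cmp x e₃
    ...   | tri≈ _ x≡e₃ _ = ⊥-elim (nonKernel-≢kernel nx k₃ x≡e₃)
    ...   | tri< x<e₃ _ _ with <-cmp (π x) (π e₂)
    ...     | tri< πx<πe₂ _ _ = ⊥-elim (shares k₁ (1≤e₁ , e₁<e₂ , e₂<x , <⇒≤ (<-≤-trans x<e₃ e₃≤n) , πe₁<πx , πx<πe₂) third first)
    ...     | tri≈ _ πx≡πe₂ _ = ⊥-elim (nonKernel-≢kernel-value nx k₂ πx≡πe₂)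
    ...     | tri> _ _ πe₂<πx = ⊥-elim (shares k₁ (1≤e₁ , e₁<x , x<e₃ , e₃≤n , πe₁<πe₃ , <-trans πe₃<πe₂ πe₂<πx) second first)
    by-position | tri> _ _ e₁<x | tri> _ _ e₂<x | tri> _ _ πe₁<πx | tri> _ _ e₃<x with <-cmp (π x) (π e₂)
    ... | tri< πx<πe₂ _ _ = ⊥-elim (shares k₁ (1≤e₁ , e₁<e₂ , e₂<x , x≤n , πe₁<πx , πx<πe₂) third first)
    ... | tri≈ _ πx≡πe₂ _ = ⊥-elim (nonKernel-≢kernel-value nx k₂ πx≡πe₂)
    ... | tri> _ _ πe₂<πx = right-above e₃<x πe₂<πx

  OffStrips : ℕ → ℕ → ℕ → Set
  OffStrips a b z = (z < a ⊎ b < z) × (π z < π a ⊎ π b < π z)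

  module Strips {a b : ℕ} (na : NonKernel a) (nb : NonKernel b) (a<b : a < b) (πa<πb : π a < π b) where

    private
      1≤a : 1 ≤ a
      1≤a = proj₁ na
      b≤n : b ≤ n
      b≤n = proj₁ (proj₂ nb)

    module _ {e₁ e₂ e₃ : ℕ} (occ : Occ132 n π e₁ e₂ e₃)
             (k₁ : InKernel n π e₁) (k₂ : InKernel n π e₂) (k₃ : InKernel n π e₃) where

      private
        e₁<e₂ : e₁ < e₂
        e₁<e₂ = proj₁ (proj₂ occ)
        e₂<e₃ : e₂ < e₃
        e₂<e₃ = proj₁ (proj₂ (proj₂ occ))
        πe₁<πe₃ : π e₁ < π e₃
        πe₁<πe₃ = proj₁ (proj₂ (proj₂ (proj₂ (proj₂ occ))))
        πe₃<πe₂ : π e₃ < π e₂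
        πe₃<πe₂ = proj₂ (proj₂ (proj₂ (proj₂ (proj₂ occ))))

      position-between : ∀ {z} → In3 z e₁ e₂ e₃ → e₁ ≤ z × z ≤ e₃
      position-between (inj₁ refl) = ≤-refl , <⇒≤ (<-trans e₁<e₂ e₂<e₃)
      position-between (inj₂ (inj₁ refl)) = <⇒≤ e₁<e₂ , <⇒≤ e₂<e₃
      position-between (inj₂ (inj₂ refl)) = <⇒≤ (<-trans e₁<e₂ e₂<e₃) , ≤-refl

      value-between : ∀ {z} → In3 z e₁ e₂ e₃ → π e₁ ≤ π z × π z ≤ π e₂
      value-between (inj₁ refl) = ≤-refl , <⇒≤ (<-trans πe₁<πe₃ πe₃<πe₂)
      value-between (inj₂ (inj₁ refl)) = <⇒≤ (<-trans πe₁<πe₃ πe₃<πe₂) , ≤-refl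
      value-between (inj₂ (inj₂ refl)) = <⇒≤ πe₁<πe₃ , <⇒≤ πe₃<πe₂

      AllOff : Set
      AllOff = OffStrips a b e₁ × OffStrips a b e₂ × OffStrips a b e₃

      NoneOff : Set
      NoneOff = ∀ {z} → In3 z e₁ e₂ e₃ → ¬ OffStrips a b z

      all-or-none : AllOff ⊎ NoneOff
      all-or-none with escape na occ k₁ k₂ k₃ | escape nb occ k₁ k₂ k₃
      ... | right-below e₂<a πa<πe₁ | right-below _ πb<πe₁ =
        inj₁ ((inj₁ (<-trans e₁<e₂ e₂<a) , inj₂ πb<πe₁) ,
              (inj₁ e₂<a , inj₂ (<-trans πb<πe₁ (<-trans πe₁<πe₃ πe₃<πe₂))) ,
              (e₃-column , inj₂ (<-trans πb<πe₁ πe₁<πe₃)))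
        where
        e₃-column : e₃ < a ⊎ b < e₃
        e₃-column with <-cmp e₃ a
        ... | tri< e₃<a _ _ = inj₁ e₃<a
        ... | tri≈ _ e₃≡a _ = ⊥-elim (nonKernel-≢kernel na k₃ (sym e₃≡a))
        ... | tri> _ _ a<e₃ with <-cmp e₃ b
        ...   | tri< e₃<b _ _ = ⊥-elim (no-shared-occurrence na k₃ (1≤a , a<e₃ , e₃<b , b≤n , πa<πb , <-trans πb<πe₁ πe₁<πe₃) first second)
        ...   | tri≈ _ e₃≡b _ = ⊥-elim (nonKernel-≢kernel nb k₃ (sym e₃≡b))
        ...   | tri> _ _ b<e₃ = inj₂ b<e₃
      ... | left-above _ πe₃<πa | left-above b<e₁ _ =
        inj₁ ((inj₂ b<e₁ , inj₁ (<-trans πe₁<πe₃ πe₃<πa)) ,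
              (inj₂ (<-trans b<e₁ e₁<e₂) , e₂-row) ,
              (inj₂ (<-trans b<e₁ (<-trans e₁<e₂ e₂<e₃)) , inj₁ πe₃<πa))
        where
        e₂-row : π e₂ < π a ⊎ π b < π e₂
        e₂-row with <-cmp (π e₂) (π a)
        ... | tri< πe₂<πa _ _ = inj₁ πe₂<πa
        ... | tri≈ _ πe₂≡πa _ = ⊥-elim (nonKernel-≢kernel-value na k₂ (sym πe₂≡πa))
        ... | tri> _ _ πa<πe₂ with <-cmp (π e₂) (π b)
        ...   | tri< πe₂<πb _ _ =
          ⊥-elim (no-shared-occurrence na k₂ (1≤a , a<b , <-trans b<e₁ e₁<e₂ , proj₂ (occurrence-range occ second) , πa<πe₂ , πe₂<πb) first third)
        ...   | tri≈ _ πe₂≡πb _ = ⊥-elim (nonKernel-≢kernel-value nb k₂ (sym πe₂≡πb))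
        ...   | tri> _ _ πb<πe₂ = inj₂ πb<πe₂
      ... | right-above e₃<a πe₂<πa | right-above _ _ =
        inj₁ ((inj₁ (<-trans e₁<e₂ (<-trans e₂<e₃ e₃<a)) , inj₁ (<-trans πe₁<πe₃ (<-trans πe₃<πe₂ πe₂<πa))) ,
              (inj₁ (<-trans e₂<e₃ e₃<a) , inj₁ πe₂<πa) ,
              (inj₁ e₃<a , inj₁ (<-trans πe₃<πe₂ πe₂<πa)))
      ... | left-above _ πe₃<πa | right-below _ πb<πe₁ = ⊥-elim (<-asym πa<πb (<-trans πb<πe₁ (<-trans πe₁<πe₃ πe₃<πa)))
      ... | right-below e₂<a _ | left-above b<e₁ _ = ⊥-elim (<-asym a<b (<-trans b<e₁ (<-trans e₁<e₂ e₂<a)))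
      ... | right-above e₃<a _ | left-above b<e₁ _ = ⊥-elim (<-asym a<b (<-trans b<e₁ (<-trans e₁<e₂ (<-trans e₂<e₃ e₃<a))))
      ... | right-above _ πe₂<πa | right-below _ πb<πe₁ =
        ⊥-elim (<-asym πa<πb (<-trans πb<πe₁ (<-trans (<-trans πe₁<πe₃ πe₃<πe₂) πe₂<πa)))
      ... | left-above a<e₁ _ | right-above e₃<b _ = inj₂ λ z∈ off → let (e₁≤z , z≤e₃) = position-between z∈ in
        [ (λ z<a → <-asym z<a (<-≤-trans a<e₁ e₁≤z)) , (λ b<z → <-asym b<z (≤-<-trans z≤e₃ e₃<b)) ] (proj₁ off)
      ... | right-below _ πa<πe₁ | right-above _ πe₂<πb = inj₂ λ z∈ off → let (πe₁≤πz , πz≤πe₂) = value-between z∈ in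
        [ (λ πz<πa → <-asym πz<πa (<-≤-trans πa<πe₁ πe₁≤πz)) , (λ πb<πz → <-asym πb<πz (≤-<-trans πz≤πe₂ πe₂<πb)) ] (proj₂ off)

      offStrips-propagates : ∀ {z w} → In3 z e₁ e₂ e₃ → OffStrips a b z → In3 w e₁ e₂ e₃ → OffStrips a b w
      offStrips-propagates z∈ off w∈ with all-or-none
      ... | inj₂ none = ⊥-elim (none z∈ off)
      ... | inj₁ (off₁ , off₂ , off₃) with w∈
      ...   | inj₁ refl = off₁
      ...   | inj₂ (inj₁ refl) = off₂
      ...   | inj₂ (inj₂ refl) = off₃

    -- The entry n is off the strips, and being off the strips spreads along the occurrences of 132.
    kernel-offStrips : ∀ {z} → InKernel n π z → OffStrips a b z
    kernel-offStrips (_ , _ , p , 1≤p , p≤n , πp≡n , path) = along p∈K p-off path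
      where
      p∈K : InKernel n π p
      p∈K = 1≤p , p≤n , p , 1≤p , p≤n , πp≡n , ε
      πb<πp : π b < π p
      πb<πp = subst (π b <_) (sym πp≡n) (nonKernel<n nb)
      p-off : OffStrips a b p
      p-off = p-column , inj₂ πb<πp
        where
        p-column : p < a ⊎ b < p
        p-column with <-cmp p a
        ... | tri< p<a _ _ = inj₁ p<a
        ... | tri≈ _ p≡a _ = ⊥-elim (nonKernel-≢kernel na p∈K (sym p≡a))
        ... | tri> _ _ a<p with <-cmp p b
        ...   | tri< p<b _ _ = ⊥-elim (no-shared-occurrence na p∈K (1≤a , a<p , p<b , b≤n , πa<πb , πb<πp) first second)
        ...   | tri≈ _ p≡b _ = ⊥-elim (nonKernel-≢kernel nb p∈K (sym p≡b))
        ...   | tri> _ _ b<p = inj₂ b<p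
      along : ∀ {x y} → InKernel n π x → OffStrips a b x → Star (Adj n π) x y → OffStrips a b y
      along _ x-off ε = x-off
      along x∈K x-off (adj@(e₁ , e₂ , e₃ , occ , x∈ , y∈) ◅ rest) =
        along (in-kernel y∈) (offStrips-propagates occ (in-kernel first) (in-kernel second) (in-kernel third) x∈ x-off y∈) rest
        where
        in-kernel : ∀ {w} → In3 w e₁ e₂ e₃ → InKernel n π w
        in-kernel w∈ = kernel-extend x∈K (e₁ , e₂ , e₃ , occ , x∈ , w∈) (proj₁ (occurrence-range occ w∈)) (proj₂ (occurrence-range occ w∈))

  cell-entry-nonKernel : ∀ {m l x} → 1 ≤ l → l ≤ suc s → InCell m l x → NonKernel x
  cell-entry-nonKernel {m} {l} {x} 1≤l l≤ x∈C@(i<x , x<i , _) = 1≤x , x≤n , λ x∈K →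
    let (k , 1≤k , k≤s , ik≡x) = kernel-index (kernel⇒∈ks x∈K)
    in kernel-not-in-cell 1≤l l≤ 1≤k k≤s (subst (InCell m l) (sym ik≡x) x∈C)
    where
    1≤x : 1 ≤ x
    1≤x = ≤-<-trans z≤n i<x
    x≤n : x ≤ n
    x≤n = ≤-pred (<-≤-trans x<i (subst (ipos l ≤_) ipos-last (ipos-mono l (suc s) l≤ ≤-refl)))

  right-of-column : ∀ {m l p k} → InCell m l p → l ≤ k → k ≤ s → p < ipos k
  right-of-column {l = l} {k = k} (_ , p<il , _) l≤k k≤s = <-≤-trans p<il (ipos-mono l k l≤k (m≤n⇒m≤1+n k≤s))

  left-of-column : ∀ {m l p k} → InCell m l p → k < l → l ≤ suc s → ipos k < p
  left-of-column (il-1<p , _) k<l l≤ = ≤-<-trans (ipos≤ipos-pred k<l l≤) il-1<p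

  -- Two increasing non-kernel entries in different cells would be separated by a kernel entry,
  -- in position or in value, contradicting kernel-offStrips.
  increasing-pair-same-cell : ∀ {m l m′ l′ a b} → IsCell m l → IsCell m′ l′ →
    InCell m l a → InCell m′ l′ b → a < b → π a < π b → m ≡ m′ × l ≡ l′
  increasing-pair-same-cell {m} {l} {m′} {l′} {a} {b} ((1≤m , m≤s) , (1≤l , l≤)) ((1≤m′ , m′≤s) , (1≤l′ , l′≤))
                            a∈C@(_ , a<il , _ , πa<up) b∈C@(_ , b<il′ , lo′<πb , πb<up′) a<b πa<πb = same-row , same-column
    where
    offStrips : ∀ {z} → InKernel n π z → OffStrips a b z
    offStrips = Strips.kernel-offStrips (cell-entry-nonKernel 1≤l l≤ a∈C) (cell-entry-nonKernel 1≤l′ l′≤ b∈C) a<b πa<πb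
    same-column : l ≡ l′
    same-column with <-cmp l l′
    ... | tri≈ _ l≡l′ _ = l≡l′
    ... | tri> _ _ l′<l = ⊥-elim (<-asym a<b (<-trans b<il′ (left-of-column a∈C l′<l l≤)))
    ... | tri< l<l′ _ _ =
      let l≤s = ≤-pred (<-≤-trans l<l′ l′≤)
      in ⊥-elim ([ (λ il<a → <-asym il<a a<il) , (λ b<il → <-asym b<il (left-of-column b∈C l<l′ l′≤)) ]
                   (proj₁ (offStrips (∈ks⇒kernel (ipos-∈ks l 1≤l l≤s)))))
    same-row : m ≡ m′
    same-row with <-cmp m m′
    ... | tri≈ _ m≡m′ _ = m≡m′
    ... | tri< m<m′ _ _ =
      let ((1≤i , i≤s) , _) = ρinv-inverse m 1≤m m≤s
          up≤lo′ : up m ≤ low m′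
          up≤lo′ = subst (up m ≤_) (sym (low≡up-pred m′ (≤-trans (s≤s 1≤m) m<m′)))
                     (up-mono m (m′ ∸ 1) 1≤m (m<n⇒m≤n∸1 m<m′) (≤-trans (m∸n≤m m′ 1) m′≤s))
      in ⊥-elim ([ (λ up<πa → <-asym up<πa πa<up) , (λ πb<up → <-asym πb<up (≤-<-trans up≤lo′ lo′<πb)) ]
                   (proj₂ (offStrips (∈ks⇒kernel (ipos-∈ks (ρinv m) 1≤i i≤s)))))
    ... | tri> _ _ m′<m =
      let up′≤lo : up m′ ≤ low m
          up′≤lo = subst (up m′ ≤_) (sym (low≡up-pred m (≤-trans (s≤s 1≤m′) m′<m)))
                     (up-mono m′ (m ∸ 1) 1≤m′ (m<n⇒m≤n∸1 m′<m) (≤-trans (m∸n≤m m 1) m≤s))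
          (_ , _ , lo<πa , _) = a∈C
      in ⊥-elim (<-asym πa<πb (<-trans πb<up′ (≤-<-trans up′≤lo lo<πa)))

  distinct-cells-decreasing : ∀ {m l m′ l′ a b} → IsCell m l → IsCell m′ l′ → InCell m l a → InCell m′ l′ b →
    (m , l) ≢ (m′ , l′) → a < b → π b < π a
  distinct-cells-decreasing C@(_ , (1≤l , l≤)) C′@(_ , (1≤l′ , l′≤)) a∈C b∈C′ C≢C′ a<b =
    let (1≤a , a≤n , _) = cell-entry-nonKernel 1≤l l≤ a∈C
        (1≤b , b≤n , _) = cell-entry-nonKernel 1≤l′ l′≤ b∈C′
    in ≤∧≢⇒< (≮⇒≥ (λ πa<πb → C≢C′ (let (m≡ , l≡) = increasing-pair-same-cell C C′ a∈C b∈C′ a<b πa<πb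
                                     in cong₂ _,_ m≡ l≡)))
             (λ πb≡πa → <-irrefl (π-injective _ _ 1≤a a≤n 1≤b b≤n (sym πb≡πa)) a<b)

  distinct-cells-inverted : ∀ {m l m′ l′ x y} → IsCell m l → IsCell m′ l′ →
    InCell m l x → InCell m′ l′ y → (m , l) ≢ (m′ , l′) → inversionAt π x y + inversionAt π y x ≡ 1
  distinct-cells-inverted {m′ = m′} {l′} {x} {y} C C′ x∈C y∈C′ C≢C′ with <-cmp x y
  ... | tri< x<y _ _ = inversionAt-pair π x<y (distinct-cells-decreasing C C′ x∈C y∈C′ C≢C′ x<y)
  ... | tri≈ _ x≡y _ = ⊥-elim (C≢C′ (let (m≡ , l≡) = cell-unique C C′ x∈C (subst (InCell m′ l′) (sym x≡y) y∈C′)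
                                      in cong₂ _,_ m≡ l≡))
  ... | tri> _ _ y<x = trans (+-comm (inversionAt π x y) _)
    (inversionAt-pair π y<x (distinct-cells-decreasing C′ C y∈C′ x∈C (λ C′≡C → C≢C′ (sym C′≡C)) y<x))

  cell-kernel-inversion : ∀ {m l p k} → IsCell m l → InCell m l p → 1 ≤ k → k ≤ s →
    inversionAt π p (ipos k) + inversionAt π (ipos k) p
      ≡ (if ((m ≤ᵇ ρ k) ∧ (k <ᵇ l)) ∨ ((ρ k <ᵇ m) ∧ (l ≤ᵇ k)) then 1 else 0)
  cell-kernel-inversion {m} {l} {p} {k} ((1≤m , m≤s) , (_ , l≤)) p∈C@(_ , _ , lo<πp , πp<up) 1≤k k≤s = begin
      (if (p <ᵇ ipos k) ∧ (kval k <ᵇ π p) then 1 else 0) + (if (ipos k <ᵇ p) ∧ (π p <ᵇ kval k) then 1 else 0)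
    ≡⟨ cong₂ (λ u v → (if u then 1 else 0) + (if v then 1 else 0))
             (cong₂ _∧_ (trans kernel-right (≤ᵇ≡not<ᵇ l k)) kernel-below)
             (cong₂ _∧_ kernel-left (trans kernel-above (≤ᵇ≡not<ᵇ m (ρ k)))) ⟩
      (if not (k <ᵇ l) ∧ (ρ k <ᵇ m) then 1 else 0) + (if (k <ᵇ l) ∧ not (ρ k <ᵇ m) then 1 else 0)
    ≡⟨ exactly-one (k <ᵇ l) (ρ k <ᵇ m) ⟩
      (if (not (ρ k <ᵇ m) ∧ (k <ᵇ l)) ∨ ((ρ k <ᵇ m) ∧ not (k <ᵇ l)) then 1 else 0)
    ≡⟨ cong (λ u → if u then 1 else 0)
            (cong₂ (λ u v → (u ∧ (k <ᵇ l)) ∨ ((ρ k <ᵇ m) ∧ v)) (sym (≤ᵇ≡not<ᵇ m (ρ k))) (sym (≤ᵇ≡not<ᵇ l k))) ⟩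
      (if ((m ≤ᵇ ρ k) ∧ (k <ᵇ l)) ∨ ((ρ k <ᵇ m) ∧ (l ≤ᵇ k)) then 1 else 0) ∎
    where
    open ≡-Reasoning
    exactly-one : ∀ a c → (if not a ∧ c then 1 else 0) + (if a ∧ not c then 1 else 0)
                          ≡ (if (not c ∧ a) ∨ (c ∧ not a) then 1 else 0)
    exactly-one true true = refl
    exactly-one true false = refl
    exactly-one false true = refl
    exactly-one false false = refl
    kernel-right : (p <ᵇ ipos k) ≡ (l ≤ᵇ k)
    kernel-right with l ≤? k
    ... | yes l≤k = trans (<ᵇ-true⁺ (right-of-column p∈C l≤k k≤s)) (sym (≤ᵇ-true⁺ l≤k))
    ... | no l≰k = trans (<ᵇ-false⁺ (<⇒≯ (left-of-column p∈C (≰⇒> l≰k) l≤))) (sym (≤ᵇ-false⁺ l≰k))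
    kernel-left : (ipos k <ᵇ p) ≡ (k <ᵇ l)
    kernel-left with k <? l
    ... | yes k<l = trans (<ᵇ-true⁺ (left-of-column p∈C k<l l≤)) (sym (<ᵇ-true⁺ k<l))
    ... | no k≮l = trans (<ᵇ-false⁺ (<⇒≯ (right-of-column p∈C (≮⇒≥ k≮l) k≤s))) (sym (<ᵇ-false⁺ k≮l))
    kernel-below : (kval k <ᵇ π p) ≡ (ρ k <ᵇ m)
    kernel-below with ρ k <? m
    ... | yes ρk<m = trans (<ᵇ-true⁺ (kval-below-row k m 1≤k k≤s m≤s lo<πp ρk<m)) (sym (<ᵇ-true⁺ ρk<m))
    ... | no ρk≮m = trans (<ᵇ-false⁺ (<⇒≯ (kval-above-row k m 1≤k k≤s 1≤m πp<up (≮⇒≥ ρk≮m)))) (sym (<ᵇ-false⁺ ρk≮m))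
    kernel-above : (π p <ᵇ kval k) ≡ (m ≤ᵇ ρ k)
    kernel-above with ρ k <? m
    ... | yes ρk<m = trans (<ᵇ-false⁺ (<⇒≯ (kval-below-row k m 1≤k k≤s m≤s lo<πp ρk<m))) (sym (≤ᵇ-false⁺ (<⇒≱ ρk<m)))
    ... | no ρk≮m = trans (<ᵇ-true⁺ (kval-above-row k m 1≤k k≤s 1≤m πp<up (≮⇒≥ ρk≮m))) (sym (≤ᵇ-true⁺ (≮⇒≥ ρk≮m)))

  -- The kernel entries together with an entry j of C_{ml} realise the word ins m l in π,
  -- its q-th letter sitting at `position q`.
  module Insertion {m l j : ℕ} (C : IsCell m l) (j∈C : InCell m l j) where

    private
      1≤m : 1 ≤ m
      1≤m = proj₁ (proj₁ C)
      m≤s : m ≤ s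
      m≤s = proj₂ (proj₁ C)
      1≤l : 1 ≤ l
      1≤l = proj₁ (proj₂ C)
      l≤ : l ≤ suc s
      l≤ = proj₂ (proj₂ C)

    position : ℕ → ℕ
    position q = if q <ᵇ l then ipos q else (if q ≡ᵇ l then j else ipos (q ∸ 1))

    data Slot (q : ℕ) : Set where
      before : q < l → ins m l q ≡ 2 * ρ q → position q ≡ ipos q → Slot q
      at : q ≡ l → ins m l q ≡ 2 * m ∸ 1 → position q ≡ j → Slot q
      after : l < q → ins m l q ≡ 2 * ρ (q ∸ 1) → position q ≡ ipos (q ∸ 1) → Slot q

    slot : ∀ q → Slot q
    slot q with q <? l
    ... | yes q<l = before q<l (if-true (<ᵇ-true⁺ q<l)) (if-true (<ᵇ-true⁺ q<l))
    ... | no q≮l with q ≟ l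
    ...   | yes q≡l = at q≡l (trans (if-false (<ᵇ-false⁺ q≮l)) (if-true (≡ᵇ-true⁺ q≡l)))
                             (trans (if-false (<ᵇ-false⁺ q≮l)) (if-true (≡ᵇ-true⁺ q≡l)))
    ...   | no q≢l = after (≤∧≢⇒< (≮⇒≥ q≮l) (λ l≡q → q≢l (sym l≡q)))
                           (trans (if-false (<ᵇ-false⁺ q≮l)) (if-false (≡ᵇ-false⁺ q≢l)))
                           (trans (if-false (<ᵇ-false⁺ q≮l)) (if-false (≡ᵇ-false⁺ q≢l)))

    data KernelLetter (q : ℕ) : Set where
      kernelLetter : ∀ k → 1 ≤ k → k ≤ s → ins m l q ≡ 2 * ρ k → position q ≡ ipos k → KernelLetter q

    kernel-letter : ∀ q → 1 ≤ q → q ≤ suc s → q ≢ l → KernelLetter q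
    kernel-letter q 1≤q q≤ q≢l with slot q
    ... | before q<l ins≡ pos≡ = kernelLetter q 1≤q (≤-pred (<-≤-trans q<l l≤)) ins≡ pos≡
    ... | at q≡l _ _ = ⊥-elim (q≢l q≡l)
    ... | after l<q ins≡ pos≡ = kernelLetter (q ∸ 1) (m<n⇒m≤n∸1 (≤-<-trans 1≤l l<q)) (∸-monoˡ-≤ 1 q≤) ins≡ pos≡

    inserted-letter : ∀ q → q ≡ l → ins m l q ≡ 2 * m ∸ 1 × position q ≡ j
    inserted-letter q q≡l with slot q
    ... | at _ ins≡ pos≡ = ins≡ , pos≡
    ... | before q<l _ _ = ⊥-elim (<-irrefl q≡l q<l)
    ... | after l<q _ _ = ⊥-elim (<-irrefl (sym q≡l) l<q)

    j-nonKernel : NonKernel j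
    j-nonKernel = cell-entry-nonKernel 1≤l l≤ j∈C

    position-range : ∀ q → 1 ≤ q → q ≤ suc s → 1 ≤ position q × position q ≤ n
    position-range q 1≤q q≤ with q ≟ l
    ... | no q≢l with kernel-letter q 1≤q q≤ q≢l
    ...   | kernelLetter k 1≤k k≤s _ pos≡ = subst (λ p → 1 ≤ p × p ≤ n) (sym pos≡) (ipos-range k 1≤k k≤s)
    position-range q 1≤q q≤ | yes q≡l =
      subst (λ p → 1 ≤ p × p ≤ n) (sym (proj₂ (inserted-letter q q≡l))) (proj₁ j-nonKernel , proj₁ (proj₂ j-nonKernel))

    position-kernel : ∀ q → 1 ≤ q → q ≤ suc s → q ≢ l → InKernel n π (position q)
    position-kernel q 1≤q q≤ q≢l with kernel-letter q 1≤q q≤ q≢l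
    ... | kernelLetter k 1≤k k≤s _ pos≡ = subst (InKernel n π) (sym pos≡) (∈ks⇒kernel (ipos-∈ks k 1≤k k≤s))

    position-strictMono : ∀ q q′ → q < q′ → q′ ≤ suc s → position q < position q′
    position-strictMono q q′ q<q′ q′≤ with slot q | slot q′
    ... | before _ _ p≡ | before _ _ p′≡ rewrite p≡ | p′≡ = ipos-strictMono q q′ q<q′ q′≤
    ... | before q<l _ p≡ | at refl _ p′≡ rewrite p≡ | p′≡ = left-of-column j∈C q<l l≤
    ... | before q<l _ p≡ | after l<q′ _ p′≡ rewrite p≡ | p′≡ =
      ipos-strictMono q (q′ ∸ 1) (<-≤-trans q<l (m<n⇒m≤n∸1 l<q′)) (≤-trans (m∸n≤m q′ 1) q′≤)
    ... | at refl _ p≡ | after l<q′ _ p′≡ rewrite p≡ | p′≡ =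
      <-≤-trans (proj₁ (proj₂ j∈C)) (ipos-mono l (q′ ∸ 1) (m<n⇒m≤n∸1 l<q′) (≤-trans (m∸n≤m q′ 1) q′≤))
    ... | after l<q _ p≡ | after _ _ p′≡ rewrite p≡ | p′≡ =
      ipos-strictMono (q ∸ 1) (q′ ∸ 1) (∸-monoˡ-< q<q′ (≤-trans (s≤s z≤n) l<q)) (≤-trans (m∸n≤m q′ 1) q′≤)
    ... | at refl _ _ | before q′<l _ _ = ⊥-elim (<-asym q<q′ q′<l)
    ... | at refl _ _ | at q′≡l _ _ = ⊥-elim (<-irrefl (sym q′≡l) q<q′)
    ... | after l<q _ _ | before q′<l _ _ = ⊥-elim (<-asym q′<l (<-trans l<q q<q′))
    ... | after l<q _ _ | at refl _ _ = ⊥-elim (<-asym l<q q<q′)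

    position-values : ∀ q q′ → 1 ≤ q → q ≤ suc s → 1 ≤ q′ → q′ ≤ suc s → q ≢ q′ →
      ins m l q < ins m l q′ → π (position q) < π (position q′)
    position-values q q′ 1≤q q≤ 1≤q′ q′≤ q≢q′ ins< with q ≟ l | q′ ≟ l
    ... | yes q≡l | yes q′≡l = ⊥-elim (q≢q′ (trans q≡l (sym q′≡l)))
    ... | no q≢l | no q′≢l with kernel-letter q 1≤q q≤ q≢l | kernel-letter q′ 1≤q′ q′≤ q′≢l
    ...   | kernelLetter k 1≤k k≤s ins≡ pos≡ | kernelLetter k′ 1≤k′ k′≤s ins′≡ pos′≡ rewrite ins≡ | ins′≡ | pos≡ | pos′≡ =
      ρ-cancel-< 1≤k k≤s 1≤k′ k′≤s (2x<2y⇒x<y ins<)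
    position-values q q′ 1≤q q≤ 1≤q′ q′≤ q≢q′ ins< | no q≢l | yes q′≡l
      with kernel-letter q 1≤q q≤ q≢l | inserted-letter q′ q′≡l
    ... | kernelLetter k 1≤k k≤s ins≡ pos≡ | ins′≡ , pos′≡ rewrite ins≡ | ins′≡ | pos≡ | pos′≡ =
      kval-below-row k m 1≤k k≤s m≤s (proj₁ (proj₂ (proj₂ j∈C))) (2x<2m∸1⇒x<m ins<)
    position-values q q′ 1≤q q≤ 1≤q′ q′≤ q≢q′ ins< | yes q≡l | no q′≢l
      with inserted-letter q q≡l | kernel-letter q′ 1≤q′ q′≤ q′≢l
    ... | ins≡ , pos≡ | kernelLetter k 1≤k k≤s ins′≡ pos′≡ rewrite ins≡ | ins′≡ | pos≡ | pos′≡ =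
      kval-above-row k m 1≤k k≤s 1≤m (proj₂ (proj₂ (proj₂ j∈C))) (2m∸1<2x⇒m≤x ins<)

    ordered-letters : ∀ {a b c} → 1 ≤ a → a < b → b < c → c ≤ suc s → a ≤ suc s × (1 ≤ b × b ≤ suc s) × 1 ≤ c
    ordered-letters 1≤a a<b b<c c≤ =
      let b≤ = <⇒≤ (<-≤-trans b<c c≤) ; 1≤b = ≤-trans 1≤a (<⇒≤ a<b)
      in <⇒≤ (<-≤-trans a<b b≤) , (1≤b , b≤) , ≤-trans 1≤b (<⇒≤ b<c)

    letters-occurrence : ∀ {a b c} → 1 ≤ a → a < b → b < c → c ≤ suc s →
      ins m l a < ins m l c → ins m l c < ins m l b → Occ132 n π (position a) (position b) (position c)
    letters-occurrence {a} {b} {c} 1≤a a<b b<c c≤ ac cb =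
      let (a≤ , (1≤b , b≤) , 1≤c) = ordered-letters 1≤a a<b b<c c≤
      in proj₁ (position-range a 1≤a a≤) , position-strictMono a b a<b b≤ , position-strictMono b c b<c c≤ ,
         proj₂ (position-range c 1≤c c≤) ,
         position-values a c 1≤a a≤ 1≤c c≤ (<⇒≢ (<-trans a<b b<c)) ac ,
         position-values c b 1≤c c≤ 1≤b b≤ (λ c≡b → <⇒≢ b<c (sym c≡b)) cb

    j-at : ∀ q → l ≡ q → j ≡ position q
    j-at q l≡q = sym (proj₂ (inserted-letter q (sym l≡q)))

    -- The other two letters are kernel letters, so j would share an occurrence with the kernel.
    no-occurrence-through-j : ∀ {a b c} → 1 ≤ a → a < b → b < c → c ≤ suc s →
      Occ132 n π (position a) (position b) (position c) → In3 l a b c → ⊥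
    no-occurrence-through-j {a} {b} {c} 1≤a a<b b<c c≤ occ (inj₁ l≡a) =
      let (_ , (1≤b , b≤) , _) = ordered-letters 1≤a a<b b<c c≤
      in no-shared-occurrence j-nonKernel (position-kernel b 1≤b b≤ (λ b≡l → <-irrefl (trans (sym l≡a) (sym b≡l)) a<b))
           occ (inj₁ (j-at a l≡a)) second
    no-occurrence-through-j {a} {b} {c} 1≤a a<b b<c c≤ occ (inj₂ (inj₁ l≡b)) =
      let (a≤ , _ , _) = ordered-letters 1≤a a<b b<c c≤
      in no-shared-occurrence j-nonKernel (position-kernel a 1≤a a≤ (λ a≡l → <-irrefl (trans a≡l l≡b) a<b))
           occ (inj₂ (inj₁ (j-at b l≡b))) first
    no-occurrence-through-j {a} {b} {c} 1≤a a<b b<c c≤ occ (inj₂ (inj₂ l≡c)) =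
      let (a≤ , _ , _) = ordered-letters 1≤a a<b b<c c≤
      in no-shared-occurrence j-nonKernel (position-kernel a 1≤a a≤ (λ a≡l → <-irrefl (trans a≡l l≡c) (<-trans a<b b<c)))
           occ (inj₂ (inj₂ (j-at c l≡c))) first

    infeasible-empty : infeasible m l ≡ true → ⊥
    infeasible-empty holds with any-true⁻ _ (range (suc s)) holds
    ... | a , a∈ , holds-a with any-true⁻ _ (range (suc s)) holds-a
    ... | b , b∈ , holds-b with any-true⁻ _ (range (suc s)) holds-b
    ... | c , c∈ , holds-c =
      let (a<ᵇb , rest₁) = ∧-true holds-c ; (b<ᵇc , rest₂) = ∧-true rest₁
          (ac , rest₃) = ∧-true rest₂ ; (cb , through-l) = ∧-true rest₃
          a<b = <ᵇ-true⁻ a<ᵇb ; b<c = <ᵇ-true⁻ b<ᵇc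
          1≤a = proj₁ (∈-range⁻ a∈) ; c≤ = proj₂ (∈-range⁻ c∈)
      in no-occurrence-through-j 1≤a a<b b<c c≤
           (letters-occurrence 1≤a a<b b<c c≤ (<ᵇ-true⁻ ac) (<ᵇ-true⁻ cb)) (l∈ (∨-true through-l))
      where
      l∈ : (a ≡ᵇ l) ≡ true ⊎ ((b ≡ᵇ l) ∨ (c ≡ᵇ l)) ≡ true → In3 l a b c
      l∈ (inj₁ a≡l) = inj₁ (sym (≡ᵇ-true⁻ a≡l))
      l∈ (inj₂ b∨c) with ∨-true b∨c
      ... | inj₁ b≡l = inj₂ (inj₁ (sym (≡ᵇ-true⁻ b≡l)))
      ... | inj₂ c≡l = inj₂ (inj₂ (sym (≡ᵇ-true⁻ c≡l)))

  cellRow : ℕ → List (ℕ × ℕ)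
  cellRow m = map (λ l → (m , l)) (range (suc s))

  allCells-∈⁻ : ∀ {m l} → (m , l) ∈ allCells → IsCell m l
  allCells-∈⁻ C∈ with find (∈-concatMap⁻ cellRow {xs = reverse (range s)} C∈)
  ... | m′ , m′∈ , C∈row with ∈-map⁻ (λ l → (m′ , l)) C∈row
  ...   | l′ , l′∈ , refl = ∈-range⁻ (Any.reverse⁻ m′∈) , ∈-range⁻ l′∈

  allCells-∈⁺ : ∀ {m l} → IsCell m l → (m , l) ∈ allCells
  allCells-∈⁺ {m} ((1≤m , m≤s) , (1≤l , l≤)) =
    ∈-concatMap⁺ cellRow (Any.map (λ { refl → ∈-map⁺ (λ l → (m , l)) (∈-range⁺ 1≤l l≤) }) (Any.reverse⁺ (∈-range⁺ 1≤m m≤s)))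

  allCells-unique : Unique allCells
  allCells-unique = Unique.concat⁺ (All.tabulate (λ {row} row∈ → row-unique row∈)) (AllPairs.map⁺ (AllPairs.map rows-disjoint rows-unique))
    where
    range-unique : ∀ N → Unique (range N)
    range-unique N = AllPairs.map (λ i<j → <⇒≢ i<j) (range-sorted N)
    rows-unique : Unique (reverse (range s))
    rows-unique = Unique-resp-↭ (↭-sym (↭-reverse (range s))) (range-unique s)
    row-unique : ∀ {row} → row ∈ map cellRow (reverse (range s)) → Unique row
    row-unique row∈ with ∈-map⁻ cellRow row∈
    ... | m , _ , refl = Unique.map⁺ (λ { refl → refl }) (range-unique (suc s))
    rows-disjoint : ∀ {m m′} → m ≢ m′ → Disjoint (cellRow m) (cellRow m′)
    rows-disjoint {m} {m′} m≢m′ (C∈ , C∈′) with ∈-map⁻ (λ l → (m , l)) C∈ | ∈-map⁻ (λ l → (m′ , l)) C∈′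
    ... | _ , _ , refl | _ , _ , C≡ = m≢m′ (cong proj₁ C≡)

  FC : List (ℕ × ℕ)
  FC = feasibleCells

  FC-unique : Unique FC
  FC-unique = AllPairs.filter⁺ _ allCells-unique

  FC-isCell : ∀ {m l} → (m , l) ∈ FC → IsCell m l
  FC-isCell C∈ = allCells-∈⁻ (proj₁ (∈-filterᵇ⁻ _ C∈))

  occupied⇒feasible : ∀ {m l j} → IsCell m l → InCell m l j → (m , l) ∈ FC
  occupied⇒feasible {m} {l} C j∈C = ∈-filterᵇ⁺ _ (allCells-∈⁺ C) feasible
    where
    feasible : not (infeasible m l) ≡ true
    feasible with infeasible m l in holds
    ... | false = refl
    ... | true = ⊥-elim (Insertion.infeasible-empty C j∈C holds)

  inCellᶜ : ℕ × ℕ → ℕ → Bool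
  inCellᶜ (m , l) = inCell m l

  cellPositions : ℕ × ℕ → List ℕ
  cellPositions C = filterᵇ (inCellᶜ C) (range n)

  cellPositions-sorted : ∀ C → AllPairs _<_ (cellPositions C)
  cellPositions-sorted C = AllPairs.filter⁺ _ (range-sorted n)

  cellPositions-inCell : ∀ m l {x} → x ∈ cellPositions (m , l) → InCell m l x
  cellPositions-inCell m l {x} x∈ = inCell-true⁻ m l x (proj₂ (∈-filterᵇ⁻ (inCellᶜ (m , l)) {range n} x∈))

  isKernel : ℕ → Bool
  isKernel j = does (j ∈? ks)

  isKernel-true⁺ : ∀ {j} → j ∈ ks → isKernel j ≡ true
  isKernel-true⁺ {j} j∈ks with j ∈? ks
  ... | yes _ = refl
  ... | no j∉ks = ⊥-elim (j∉ks j∈ks)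

  isKernel-true⁻ : ∀ {j} → isKernel j ≡ true → j ∈ ks
  isKernel-true⁻ {j} holds with j ∈? ks
  ... | yes j∈ks = j∈ks

  kernel-positions : filterᵇ isKernel (range n) ≡ ks
  kernel-positions = sorted-≡ (AllPairs.filter⁺ _ (range-sorted n)) ks-sorted
    (λ j j∈ → isKernel-true⁻ (proj₂ (∈-filterᵇ⁻ isKernel {range n} j∈)))
    (λ j j∈ks → ∈-filterᵇ⁺ isKernel (∈-range⁺ (proj₁ (ks-range j∈ks)) (proj₂ (ks-range j∈ks))) (isKernel-true⁺ j∈ks))

  position-split : ∀ (g : ℕ → ℕ) j → j ∈ range n →
    g j ≡ (if isKernel j then g j else 0) + ∑[ C ∈ FC ] (if inCellᶜ C j then g j else 0)
  position-split g j j∈ with j ∈? ks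
  ... | yes j∈ks = sym (trans (cong (g j +_) (∑-zero FC no-cell)) (+-identityʳ (g j)))
    where
    no-cell : ∀ C → C ∈ FC → (if inCellᶜ C j then g j else 0) ≡ 0
    no-cell (m , l) C∈ with inCell m l j in holds
    ... | false = refl
    ... | true =
      let (k , 1≤k , k≤s , ik≡j) = kernel-index j∈ks
          (_ , (1≤l , l≤)) = FC-isCell C∈
      in ⊥-elim (kernel-not-in-cell 1≤l l≤ 1≤k k≤s (subst (InCell m l) (sym ik≡j) (inCell-true⁻ m l j holds)))
  ... | no j∉ks =
    let (m , l , C , j∈C) = cell-exists nonKernel
    in sym (∑-indicator-unique FC (λ C → inCellᶜ C j) (g j) FC-unique (occupied⇒feasible C j∈C) (inCell-true⁺ m l j j∈C)
             (λ { (m′ , l′) C′∈ holds′ →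
                  let (m′≡m , l′≡l) = cell-unique (FC-isCell C′∈) C (inCell-true⁻ m′ l′ j holds′) j∈C
                  in cong₂ _,_ m′≡m l′≡l }))
    where
    nonKernel : NonKernel j
    nonKernel = proj₁ (∈-range⁻ j∈) , proj₂ (∈-range⁻ j∈) , λ j∈K → j∉ks (kernel⇒∈ks j∈K)

  ∑-positions : ∀ (g : ℕ → ℕ) → ∑ (range n) g ≡ ∑ ks g + ∑[ C ∈ FC ] ∑ (cellPositions C) g
  ∑-positions g = begin
      ∑ (range n) g
    ≡⟨ ∑-cong (range n) (position-split g) ⟩
      ∑[ j ∈ range n ] ((if isKernel j then g j else 0) + ∑[ C ∈ FC ] (if inCellᶜ C j then g j else 0))
    ≡⟨ ∑-+ (range n) _ _ ⟩
      ∑[ j ∈ range n ] (if isKernel j then g j else 0) + ∑[ j ∈ range n ] ∑[ C ∈ FC ] (if inCellᶜ C j then g j else 0)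
    ≡⟨ cong₂ _+_ (trans (sym (∑-filterᵇ isKernel (range n) g)) (cong (λ K → ∑ K g) kernel-positions))
                 (trans (∑-comm (range n) FC (λ j C → if inCellᶜ C j then g j else 0))
                        (∑-cong FC (λ C _ → sym (∑-filterᵇ (inCellᶜ C) (range n) g)))) ⟩
      ∑ ks g + ∑[ C ∈ FC ] ∑ (cellPositions C) g ∎
    where open ≡-Reasoning

  cellSize : ℕ × ℕ → ℕ
  cellSize C = length (cellPositions C)

  cellPairs : ℕ × ℕ → ℕ × ℕ → ℕ
  cellPairs C C′ = ∑[ p ∈ cellPositions C ] ∑ (cellPositions C′) (inversionAt π p)

  cell-kernel-count : ∀ {C} → C ∈ FC → ∀ {x} → x ∈ cellPositions C →
    ∑[ q ∈ ks ] (inversionAt π x q + inversionAt π q x) ≡ lval C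
  cell-kernel-count {m , l} C∈ {x} x∈ = begin
      ∑[ q ∈ ks ] (inversionAt π x q + inversionAt π q x)
    ≡⟨ ∑-via-nth ks (λ q → inversionAt π x q + inversionAt π q x) ⟩
      ∑[ k ∈ range s ] (inversionAt π x (nth ks k) + inversionAt π (nth ks k) x)
    ≡⟨ ∑-cong (range s) (λ k k∈ → let (1≤k , k≤s) = ∈-range⁻ k∈ in
         trans (cong (λ q → inversionAt π x q + inversionAt π q x) (nth≡ipos k 1≤k k≤s))
               (cell-kernel-inversion (FC-isCell C∈) (cellPositions-inCell m l x∈) 1≤k k≤s)) ⟩
      ∑[ k ∈ range s ] (if ((m ≤ᵇ ρ k) ∧ (k <ᵇ l)) ∨ ((ρ k <ᵇ m) ∧ (l ≤ᵇ k)) then 1 else 0)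
    ≡⟨ sym (length-filterᵇ _ (range s)) ⟩
      lval (m , l) ∎
    where
    open ≡-Reasoning
    nth≡ipos : ∀ k → 1 ≤ k → k ≤ s → nth ks k ≡ ipos k
    nth≡ipos (suc k) _ k<s = sym (ipos-inner k k<s)

  cells-count : ∀ C C′ → C ∈ FC → C′ ∈ FC → C ≢ C′ → cellPairs C C′ + cellPairs C′ C ≡ cellSize C * cellSize C′
  cells-count C@(m , l) C′@(m′ , l′) C∈ C′∈ C≢C′ = begin
      cellPairs C C′ + cellPairs C′ C
    ≡⟨ cong (cellPairs C C′ +_) (∑-comm (cellPositions C′) (cellPositions C) (λ q p → inversionAt π q p)) ⟩
      cellPairs C C′ + ∑[ p ∈ cellPositions C ] ∑[ q ∈ cellPositions C′ ] inversionAt π q p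
    ≡⟨ sym (∑-+ (cellPositions C) _ _) ⟩
      ∑[ p ∈ cellPositions C ] (∑ (cellPositions C′) (inversionAt π p) + ∑[ q ∈ cellPositions C′ ] inversionAt π q p)
    ≡⟨ ∑-cong (cellPositions C) (λ p p∈ → trans (sym (∑-+ (cellPositions C′) _ _))
         (∑-cong (cellPositions C′) (λ q q∈ → distinct-cells-inverted (FC-isCell C∈) (FC-isCell C′∈)
            (cellPositions-inCell m l p∈) (cellPositions-inCell m′ l′ q∈) C≢C′))) ⟩
      ∑[ _ ∈ cellPositions C ] ∑[ _ ∈ cellPositions C′ ] 1
    ≡⟨ trans (∑-const (cellPositions C) _) (cong (cellSize C *_) (trans (∑-const (cellPositions C′) 1) (*-identityʳ _))) ⟩
      cellSize C * cellSize C′ ∎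
    where open ≡-Reasoning

  inversions-decomposition : inversions (map π (range n))
    ≡ (inversions ρL + ∑[ C ∈ FC ] (cellSize C * lval C))
      + (∑[ C ∈ FC ] inversions (map π (cellPositions C)) + pairSum (map cellSize FC))
  inversions-decomposition = begin
      inversions (map π (range n))
    ≡⟨ inversions-map π (range n) (range-sorted n) ⟩
      ∑[ p ∈ range n ] ∑ (range n) (inversionAt π p)
    ≡⟨ ∑∑-blocks (range n) ks FC cellPositions (inversionAt π) ∑-positions ⟩
      (∑[ p ∈ ks ] ∑ ks (inversionAt π p) + ∑[ C ∈ FC ] ∑[ p ∈ cellPositions C ] ∑[ q ∈ ks ] (inversionAt π p q + inversionAt π q p))
        + ∑[ C ∈ FC ] ∑ FC (cellPairs C)
    ≡⟨ cong₂ _+_ (cong₂ _+_ kernel-part mixed-part)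
                 (∑∑≡diagonal+pairSum FC cellPairs cellSize FC-unique cells-count) ⟩
      (inversions ρL + ∑[ C ∈ FC ] (cellSize C * lval C)) + (∑[ C ∈ FC ] cellPairs C C + pairSum (map cellSize FC))
    ≡⟨ cong (λ u → (inversions ρL + ∑[ C ∈ FC ] (cellSize C * lval C)) + (u + pairSum (map cellSize FC)))
            (∑-cong FC (λ C _ → sym (inversions-map π (cellPositions C) (cellPositions-sorted C)))) ⟩
      (inversions ρL + ∑[ C ∈ FC ] (cellSize C * lval C))
        + (∑[ C ∈ FC ] inversions (map π (cellPositions C)) + pairSum (map cellSize FC)) ∎
    where
    open ≡-Reasoning
    kernel-part : ∑[ p ∈ ks ] ∑ ks (inversionAt π p) ≡ inversions ρL
    kernel-part = trans (sym (inversions-map π ks ks-sorted)) (sym (inversions-shape (map π ks)))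
    mixed-part : ∑[ C ∈ FC ] ∑[ p ∈ cellPositions C ] ∑[ q ∈ ks ] (inversionAt π p q + inversionAt π q p)
                 ≡ ∑[ C ∈ FC ] (cellSize C * lval C)
    mixed-part = ∑-cong FC (λ C C∈ → trans (∑-cong (cellPositions C) (λ p p∈ → cell-kernel-count C∈ p∈))
                                           (∑-const (cellPositions C) (lval C)))

  cellSize≡d : ∀ C → cellSize C ≡ d C
  cellSize≡d (m , l) = sym (length-map π (cellPositions (m , l)))

  exponent≡ : exponent ≡ pairSum (map cellSize FC) + ∑[ C ∈ FC ] (cellSize C * lval C)
  exponent≡ = sym (cong₂ _+_ (cong pairSum (map-cong cellSize≡d FC))
                             (cong sum (map-cong (λ C → cong (_* lval C) (cellSize≡d C)) FC)))

  cell-signs : productℤ (map (λ { (m , l) → signSeq (cell m l) }) FC)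
               ≡ sgn (∑[ C ∈ FC ] inversions (map π (cellPositions C)))
  cell-signs = trans (cong productℤ (map-cong (λ { (m , l) → refl }) FC))
                     (productℤ-sgn FC (λ C → inversions (map π (cellPositions C))))

lemma2 : (n : ℕ) (π : ℕ → ℕ) → 1 ≤ n → IsPerm n π →
    (ks : List ℕ) → IsKernelPositions n π ks →
    signSeq (map π (range n)) ≡ Kernel.rhs n π ks
lemma2 n π n≥1 perm ks kernel = begin
    sgn (inversions (map π (range n)))
  ≡⟨ cong sgn (trans inversions-decomposition (rearrange (inversions ρL) L I P)) ⟩
    sgn (((P + L) + inversions ρL) + I)
  ≡⟨ trans (sgn-+ ((P + L) + inversions ρL) I) (cong (_*ℤ sgn I) (sgn-+ (P + L) (inversions ρL))) ⟩
    (sgn (P + L) *ℤ sgn (inversions ρL)) *ℤ sgn I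
  ≡⟨ cong₂ (λ e c → (sgn e *ℤ signSeq ρL) *ℤ c) (sym exponent≡) (sym cell-signs) ⟩
    Kernel.rhs n π ks ∎
  where
  open ≡-Reasoning
  open CellDecomposition n π n≥1 perm ks kernel
  open Kernel n π ks using (ρL; lval)
  L I P : ℕ
  L = ∑[ C ∈ FC ] (cellSize C * lval C)
  I = ∑[ C ∈ FC ] inversions (map π (cellPositions C))
  P = pairSum (map cellSize FC)
  rearrange : ∀ a m c p → (a + m) + (c + p) ≡ ((p + m) + a) + c
  rearrange = solve 4 (λ a m c p → (a :+ m) :+ (c :+ p) := ((p :+ m) :+ a) :+ c) refl
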